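{- Let $q$ be an odd prime power, $n\geq 1$ and $k\geq 2$ integers, and $\mathcal{B}$ a non-degenerate symmetric bilinear form on $\mathbb{F}_q^n$. Suppose $S\subset\mathbb{F}_q^n\setminus\{\bm{0}\}$ is $(k,2)$-orthogonal with respect to $\mathcal{B}$. Then \[ |S|\leq \left(k-1+\frac{(k-1)^2}{q-k+1}\right)\left(q^{n/2}+1\right). \]
   Context: A bilinear form on $\mathbb{F}_q^n$ is $\mathcal{B}(\bm{x},\bm{y})=\bm{x}^TA\bm{y}$ for an $n\times n$ matrix $A$ over $\mathbb{F}_q$; symmetric means $A$ symmetric and non-degenerate means $\det A\neq 0$. Two nonzero vectors are mutually orthogonal if $\mathcal{B}(\bm{v}_1,\bm{v}_2)=0$. A set $S\subset\mathbb{F}_q^n\setminus\{\bm{0}\}$ is $(k,2)$-orthogonal if among any $k$ distinct vectors of $S$ at least two are mutually orthogonal. -}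

module Defs where

open import Level using (0ℓ)
open import Data.Nat using (ℕ; zero; suc; _^_; _≡ᵇ_) renaming (_*_ to _*ℕ_)
open import Data.Fin using (Fin; zero; suc; punchIn; toℕ)
open import Data.Vec using (Vec; lookup)
open import Data.Product using (Σ; _×_; ∃; ∃-syntax)
open import Relation.Binary.PropositionalEquality using (_≡_; _≢_)
open import Relation.Binary.Definitions using (DecidableEquality)
open import Algebra.Structures using (IsCommutativeRing)
open import Function.Bundles using (_↔_)
open import Data.List.Membership.Propositional using (_∈_)
open import Data.List using (List)

record FiniteField (q : ℕ) : Set₁ where
  infixl 7 _*_
  infixl 6 _+_
  field
    Carrier  : Set
    _+_ _*_  : Carrier → Carrier → Carrier
    -_       : Carrier → Carrier
    0# 1#    : Carrier
    isCommutativeRing : IsCommutativeRing _≡_ _+_ _*_ -_ 0# 1#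
    0≢1      : 0# ≢ 1#
    inverse  : ∀ x → x ≢ 0# → ∃[ y ] (x * y ≡ 1#)
    _≟_      : DecidableEquality Carrier
    card     : Carrier ↔ Fin q

module FieldOps {q : ℕ} (F : FiniteField q) where
  open FiniteField F

  ∑ : (n : ℕ) → (Fin n → Carrier) → Carrier
  ∑ zero    f = 0#
  ∑ (suc n) f = f zero + ∑ n (λ i → f (suc i))

  sgn : ℕ → Carrier
  sgn zero    = 1#
  sgn (suc m) = - sgn m

  det : (n : ℕ) → (Fin n → Fin n → Carrier) → Carrier
  det zero    A = 1#
  det (suc n) A =
    ∑ (suc n) (λ j → sgn (toℕ j) * A zero j * det n (λ r c → A (suc r) (punchIn j c)))

  Symmetric : (n : ℕ) → (Fin n → Fin n → Carrier) → Set
  Symmetric n A = ∀ i j → A i j ≡ A j i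

  NonDegenerate : (n : ℕ) → (Fin n → Fin n → Carrier) → Set
  NonDegenerate n A = det n A ≢ 0#

  bilin : (n : ℕ) → (Fin n → Fin n → Carrier) → Vec Carrier n → Vec Carrier n → Carrier
  bilin n A x y = ∑ n (λ i → ∑ n (λ j → lookup x i * A i j * lookup y j))

  Orthogonal-k2 : (n k : ℕ) → (Fin n → Fin n → Carrier) → List (Vec Carrier n) → Set
  Orthogonal-k2 n k A S =
    (v : Fin k → Vec Carrier n) →
    (∀ i → v i ∈ S) →
    (∀ i j → v i ≡ v j → i ≡ j) →
    Σ (Fin k) λ i → Σ (Fin k) λ j → (i ≢ j) × (bilin n A (v i) (v j) ≡ 0#)

{-# OPTIONS --safe #-}

-- Write w y = A y, so that B(x, y) = x ∙ w y, and let N be the number of ordered orthogonal pairs in S.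
-- Every k vectors of S span an edge of the orthogonality graph, so the Caro–Wei bound (by the greedy
-- argument) gives |S|² ≤ (k − 1)(|S| + N).  Conversely, with G x = Σ_{y ∈ S} (q·[x ∙ w y = 0] − 1) one has
-- Σ_{x ∈ S} G x = qN − |S|², and Cauchy–Schwarz bounds its square by |S| Σ_{x ∈ F^n} (G x)².  That sum
-- splits into correlations of pairs y, z, equal to q²·#{x : x ∙ w y = x ∙ w z = 0} − q^n: this is ≤ 0
-- when w y, w z are independent (two hyperplanes meet in q^(n−2) points) and ≤ q^(n+1) otherwise, and
-- since y ↦ A y is injective each y has at most q such z.  Hence (qN − |S|²)² ≤ |S|² q² q^n, and
-- eliminating N between the two inequalities gives the bound.

module Submission where

open import Defs
open import Level using (0ℓ)
open import Algebra.Bundles using (CommutativeSemiring; CommutativeRing)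
open import Algebra.Core using (Op₂)
open import Algebra.Structures using (IsCommutativeSemiring)
open import Data.Empty using (⊥)
open import Data.Fin using (Fin; zero; suc; toℕ; punchIn; punchOut; inject₁)
open import Data.Fin.Properties
  using (suc-injective; toℕ-injective; toℕ-inject₁; punchIn-punchOut; punchInᵢ≢i; punchIn-injective)
import Data.Fin.Properties as Finₚ
open import Data.Integer as ℤ using (ℤ)
import Data.Integer.Properties as ℤₚ
open import Data.List as List using (List; []; _∷_; [_]; _++_; map; concatMap; length; filter)
open import Data.List.Extrema.Nat using (argmin; argmin-sel; f[argmin]≤f[⊤]; f[argmin]≤f[xs])
open import Data.List.Membership.Propositional using (_∈_; lose)
open import Data.List.Membership.Propositional.Properties
  using (∈-filter⁻; ∈-map⁺; ∈-concatMap⁺; ∈-tabulate⁺; ∈-∃++; ∈-++⁻; ∈-++⁺ˡ; ∈-++⁺ʳ)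
open import Data.List.Properties using (length-tabulate)
open import Data.List.Relation.Unary.All as All using (All)
open import Data.List.Relation.Unary.AllPairs using (_∷_)
open import Data.List.Relation.Unary.Any using (here; there; satisfied; any?)
open import Data.List.Relation.Unary.Unique.Propositional using (Unique)
open import Data.List.Relation.Unary.Unique.Propositional.Properties using (tabulate⁺)
open import Data.Nat as ℕ using (ℕ; zero; suc; z≤n; s≤s)
import Data.Nat.Properties as ℕₚ
open import Data.Nat.Divisibility using (_∣_)
open import Data.Nat.Primality using (Prime)
open import Data.Product using (Σ; _×_; _,_; proj₁; proj₂)
open import Data.Sum using (_⊎_; inj₁; inj₂; [_,_]′)
open import Data.Vec as Vec using (Vec; []; _∷_; lookup; replicate; tabulate; zipWith)
import Data.Vec.Properties as Vecₚ
import Data.Vec.Functional as Vector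
open import Data.Vec.Functional.Properties using (updateAt-updates; updateAt-minimal; updateAt-id-local; updateAt-cong-local)
open import Function using (_∘_; id)
open import Function.Bundles using (Inverse)
open import Relation.Binary using (Rel; Reflexive; Decidable; DecidableEquality; _Preserves₂_⟶_⟶_; tri<; tri≈; tri>)
open import Relation.Binary.PropositionalEquality
  using (_≡_; _≢_; refl; sym; trans; cong; cong₂; subst; subst₂; module ≡-Reasoning)
open import Relation.Nullary using (Dec; yes; no; ¬_; contradiction)
open import Relation.Nullary.Decidable using (_⊎-dec_; _×-dec_; ¬?; decidable-stable)
open import Relation.Unary using (Pred) renaming (Decidable to Decidable₁)
open import Relation.Unary.Properties using (∁?)

module ListSum {A : Set} {_+_ _*_ : Op₂ A} {0# 1# : A}
               (isCommutativeSemiring : IsCommutativeSemiring _≡_ _+_ _*_ 0# 1#) where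

  open IsCommutativeSemiring isCommutativeSemiring
    using (+-assoc; +-identityˡ; zeroʳ; distribˡ)

  private
    semiring : CommutativeSemiring 0ℓ 0ℓ
    semiring = record { isCommutativeSemiring = isCommutativeSemiring }

  open import Algebra.Solver.CommutativeMonoid (CommutativeSemiring.+-commutativeMonoid semiring)
    using (solve; _⊜_; _⊕_)

  sumₗ : {I : Set} → List I → (I → A) → A
  sumₗ []       f = 0#
  sumₗ (x ∷ xs) f = f x + sumₗ xs f

  module _ {I : Set} where

    sumₗ-cong : ∀ (L : List I) {f g} → (∀ {x} → x ∈ L → f x ≡ g x) → sumₗ L f ≡ sumₗ L g
    sumₗ-cong []      eq = refl
    sumₗ-cong (x ∷ L) eq = cong₂ _+_ (eq (here refl)) (sumₗ-cong L (eq ∘ there))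

    sumₗ-zero : ∀ (L : List I) → sumₗ L (λ _ → 0#) ≡ 0#
    sumₗ-zero []      = refl
    sumₗ-zero (x ∷ L) = trans (cong (0# +_) (sumₗ-zero L)) (+-identityˡ 0#)

    sumₗ-distrib-+ : ∀ (L : List I) f g → sumₗ L (λ x → f x + g x) ≡ sumₗ L f + sumₗ L g
    sumₗ-distrib-+ []      f g = sym (+-identityˡ 0#)
    sumₗ-distrib-+ (x ∷ L) f g = trans (cong ((f x + g x) +_) (sumₗ-distrib-+ L f g))
      (solve 4 (λ a b c d → (a ⊕ b) ⊕ (c ⊕ d) ⊜ (a ⊕ c) ⊕ (b ⊕ d)) refl (f x) (g x) (sumₗ L f) (sumₗ L g))

    *-distribˡ-sumₗ : ∀ c (L : List I) f → c * sumₗ L f ≡ sumₗ L (λ x → c * f x)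
    *-distribˡ-sumₗ c []      f = zeroʳ c
    *-distribˡ-sumₗ c (x ∷ L) f = trans (distribˡ c (f x) (sumₗ L f)) (cong ((c * f x) +_) (*-distribˡ-sumₗ c L f))

    sumₗ-++ : ∀ (L M : List I) f → sumₗ (L ++ M) f ≡ sumₗ L f + sumₗ M f
    sumₗ-++ []      M f = sym (+-identityˡ _)
    sumₗ-++ (x ∷ L) M f = trans (cong (f x +_) (sumₗ-++ L M f)) (sym (+-assoc (f x) _ _))

    sumₗ-filter : ∀ {P : Pred I 0ℓ} (P? : Decidable₁ P) (L : List I) f →
                  sumₗ L f ≡ sumₗ (filter P? L) f + sumₗ (filter (∁? P?) L) f
    sumₗ-filter P? []      f = sym (+-identityˡ 0#)
    sumₗ-filter P? (x ∷ L) f with P? x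
    ... | yes _ = trans (cong (f x +_) (sumₗ-filter P? L f)) (sym (+-assoc (f x) _ _))
    ... | no  _ = trans (cong (f x +_) (sumₗ-filter P? L f))
      (solve 3 (λ a b c → a ⊕ (b ⊕ c) ⊜ b ⊕ (a ⊕ c)) refl (f x) _ _)

  module _ {I J : Set} where

    sumₗ-map : ∀ (g : I → J) (L : List I) f → sumₗ (map g L) f ≡ sumₗ L (f ∘ g)
    sumₗ-map g []      f = refl
    sumₗ-map g (x ∷ L) f = cong (f (g x) +_) (sumₗ-map g L f)

    sumₗ-concatMap : ∀ (g : I → List J) (L : List I) f → sumₗ (concatMap g L) f ≡ sumₗ L (λ x → sumₗ (g x) f)
    sumₗ-concatMap g []      f = refl
    sumₗ-concatMap g (x ∷ L) f = trans (sumₗ-++ (g x) _ f) (cong (sumₗ (g x) f +_) (sumₗ-concatMap g L f))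

    sumₗ-comm : ∀ (L : List I) (M : List J) (f : I → J → A) →
                sumₗ L (λ x → sumₗ M (f x)) ≡ sumₗ M (λ y → sumₗ L (λ x → f x y))
    sumₗ-comm []      M f = sym (sumₗ-zero M)
    sumₗ-comm (x ∷ L) M f = trans (cong (sumₗ M (f x) +_) (sumₗ-comm L M f))
      (sym (sumₗ-distrib-+ M (f x) (λ y → sumₗ L (λ x → f x y))))

  module Monotone {_≤_ : Rel A 0ℓ} (≤-refl : Reflexive _≤_)
                  (+-mono-≤ : _+_ Preserves₂ _≤_ ⟶ _≤_ ⟶ _≤_) where

    sumₗ-mono : ∀ {I : Set} (L : List I) {f g} → (∀ {x} → x ∈ L → f x ≤ g x) → sumₗ L f ≤ sumₗ L g
    sumₗ-mono []      le = ≤-refl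
    sumₗ-mono (x ∷ L) le = +-mono-≤ (le (here refl)) (sumₗ-mono L (le ∘ there))

module ℕΣ where
  open import Data.Nat using (_+_; _*_; _≤_)
  open ListSum ℕₚ.+-*-isCommutativeSemiring public
  open Monotone {_≤_ = _≤_} ℕₚ.≤-refl ℕₚ.+-mono-≤ public

  𝟙 : ∀ {P : Set} → Dec P → ℕ
  𝟙 (yes _) = 1
  𝟙 (no  _) = 0

  𝟙-cong : ∀ {P Q : Set} (p : Dec P) (q : Dec Q) → (P → Q) → (Q → P) → 𝟙 p ≡ 𝟙 q
  𝟙-cong (yes _) (yes _) _   _   = refl
  𝟙-cong (yes p) (no ¬q) P⇒Q _   = contradiction (P⇒Q p) ¬q
  𝟙-cong (no ¬p) (yes q) _   Q⇒P = contradiction (Q⇒P q) ¬p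
  𝟙-cong (no _)  (no _)  _   _   = refl

  𝟙-mono : ∀ {P Q : Set} (p : Dec P) (q : Dec Q) → (P → Q) → 𝟙 p ≤ 𝟙 q
  𝟙-mono (yes p) (yes _) _   = ℕₚ.≤-refl
  𝟙-mono (yes p) (no ¬q) P⇒Q = contradiction (P⇒Q p) ¬q
  𝟙-mono (no _)  _       _   = z≤n

  𝟙-⊎ : ∀ {P Q : Set} (p : Dec P) (q : Dec Q) → 𝟙 (p ⊎-dec q) ≤ 𝟙 p + 𝟙 q
  𝟙-⊎ (yes _) _       = s≤s z≤n
  𝟙-⊎ (no _)  (yes _) = ℕₚ.≤-refl
  𝟙-⊎ (no _)  (no _)  = z≤n

  𝟙-× : ∀ {P Q : Set} (p : Dec P) (q : Dec Q) → 𝟙 p * 𝟙 q ≡ 𝟙 (p ×-dec q)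
  𝟙-× (yes _) (yes _) = refl
  𝟙-× (yes _) (no _)  = refl
  𝟙-× (no _)  _       = refl

  module _ {I : Set} where

    sumₗ-const : ∀ (L : List I) c → sumₗ L (λ _ → c) ≡ length L * c
    sumₗ-const []      c = refl
    sumₗ-const (x ∷ L) c = cong (c +_) (sumₗ-const L c)

    sumₗ-filter-≤ : ∀ {P : Pred I 0ℓ} (P? : Decidable₁ P) (L : List I) f → sumₗ (filter P? L) f ≤ sumₗ L f
    sumₗ-filter-≤ P? L f = subst (sumₗ (filter P? L) f ≤_) (sym (sumₗ-filter P? L f)) (ℕₚ.m≤m+n _ _)

    count : ∀ {P : Pred I 0ℓ} → Decidable₁ P → List I → ℕ
    count P? L = sumₗ L (𝟙 ∘ P?)

    module _ {P : Pred I 0ℓ} (P? : Decidable₁ P) where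

      count-none : ∀ L → (∀ {x} → x ∈ L → ¬ P x) → count P? L ≡ 0
      count-none []      _    = refl
      count-none (x ∷ L) none with P? x
      ... | yes px = contradiction px (none (here refl))
      ... | no  _  = count-none L (none ∘ there)

      count-some : ∀ {L x} → x ∈ L → P x → 1 ≤ count P? L
      count-some {y ∷ L} (here refl) px with P? y
      ... | yes _  = s≤s z≤n
      ... | no ¬px = contradiction px ¬px
      count-some {y ∷ L} (there x∈L) px = ℕₚ.≤-trans (count-some x∈L px) (ℕₚ.m≤n+m _ (𝟙 (P? y)))

      count≡0⇒¬ : ∀ {L x} → count P? L ≡ 0 → x ∈ L → ¬ P x
      count≡0⇒¬ count≡0 x∈L px = ℕₚ.<⇒≢ (count-some x∈L px) (sym count≡0)

      count≤1 : ∀ {L} → Unique L → (∀ {x y} → P x → P y → x ≡ y) → count P? L ≤ 1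
      count≤1 {[]}    _             _      = z≤n
      count≤1 {x ∷ L} (x∉L ∷ uniq) unique with P? x
      ... | yes px = ℕₚ.≤-reflexive (cong suc (count-none L λ y∈L py → All.lookup x∉L y∈L (unique px py)))
      ... | no  _  = count≤1 uniq unique

      count≡1 : ∀ {L x} → Unique L → x ∈ L → P x → (∀ {x y} → P x → P y → x ≡ y) → count P? L ≡ 1
      count≡1 uniq x∈L px unique = ℕₚ.≤-antisym (count≤1 uniq unique) (count-some x∈L px)

      length-filter≡count : ∀ L → length (filter P? L) ≡ count P? L
      length-filter≡count []      = refl
      length-filter≡count (x ∷ L) with P? x
      ... | yes _ = cong suc (length-filter≡count L)
      ... | no  _ = length-filter≡count L

    length≡length-filter+length-filter∁ : ∀ {P : Pred I 0ℓ} (P? : Decidable₁ P) L →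
                                          length L ≡ length (filter P? L) + length (filter (∁? P?) L)
    length≡length-filter+length-filter∁ P? L = begin
      length L
        ≡⟨ sumₗ-1 L ⟨
      sumₗ L (λ _ → 1)
        ≡⟨ sumₗ-filter P? L (λ _ → 1) ⟩
      sumₗ (filter P? L) (λ _ → 1) + sumₗ (filter (∁? P?) L) (λ _ → 1)
        ≡⟨ cong₂ _+_ (sumₗ-1 (filter P? L)) (sumₗ-1 (filter (∁? P?) L)) ⟩
      length (filter P? L) + length (filter (∁? P?) L) ∎
      where
      open ≡-Reasoning
      sumₗ-1 : ∀ L → sumₗ L (λ _ → 1) ≡ length L
      sumₗ-1 L = trans (sumₗ-const L 1) (ℕₚ.*-identityʳ (length L))

module ℤΣ where
  open import Data.Integer using (+_; -[1+_]; +≤+; _+_; _*_; _-_; -_; _≤_)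
  open import Data.Integer.Tactic.RingSolver using (solve-∀)
  open ListSum ℤₚ.+-*-isCommutativeSemiring public
  open Monotone {_≤_ = _≤_} ℤₚ.≤-refl ℤₚ.+-mono-≤ public

  i*i≥0 : ∀ i → + 0 ≤ i * i
  i*i≥0 (+ n)    = subst (+ 0 ≤_) (ℤₚ.pos-* n n) (+≤+ z≤n)
  i*i≥0 -[1+ n ] = +≤+ z≤n

  2*i*j≤i*i+j*j : ∀ i j → + 2 * (i * j) ≤ i * i + j * j
  2*i*j≤i*i+j*j i j = ℤₚ.0≤i-j⇒j≤i (subst (+ 0 ≤_) (square-of-difference i j) (i*i≥0 (i - j)))
    where
    square-of-difference : ∀ i j → (i - j) * (i - j) ≡ i * i + j * j - + 2 * (i * j)
    square-of-difference = solve-∀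

  module _ {I : Set} where

    sumₗ-const : ∀ (L : List I) c → sumₗ L (λ _ → c) ≡ + length L * c
    sumₗ-const []      c = sym (ℤₚ.*-zeroˡ c)
    sumₗ-const (x ∷ L) c = trans (cong (_+_ c) (sumₗ-const L c)) (step c (+ length L))
      where
      step : ∀ c l → c + l * c ≡ (+ 1 + l) * c
      step = solve-∀

    +-sumₗ : ∀ (L : List I) f → + ℕΣ.sumₗ L f ≡ sumₗ L (λ x → + f x)
    +-sumₗ []      f = refl
    +-sumₗ (x ∷ L) f = cong (_+_ (+ f x)) (+-sumₗ L f)

    sumₗ-affine : ∀ (L : List I) Q f k → sumₗ L (λ x → Q * f x - k) ≡ Q * sumₗ L f - + length L * k
    sumₗ-affine []      Q f k = at-nil Q k
      where
      at-nil : ∀ Q k → + 0 ≡ Q * + 0 - + 0 * k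
      at-nil = solve-∀
    sumₗ-affine (x ∷ L) Q f k =
      trans (cong (_+_ (Q * f x - k)) (sumₗ-affine L Q f k)) (regroup Q (f x) (sumₗ L f) (+ length L) k)
      where
      regroup : ∀ Q a s l k → (Q * a - k) + (Q * s - l * k) ≡ Q * (a + s) - (+ 1 + l) * k
      regroup = solve-∀

    sumₗ-affine-product : ∀ (L : List I) Q a b →
      sumₗ L (λ x → (Q * a x - + 1) * (Q * b x - + 1)) ≡
      Q * Q * sumₗ L (λ x → a x * b x) - Q * sumₗ L a - Q * sumₗ L b + + length L
    sumₗ-affine-product []      Q a b = at-nil Q
      where
      at-nil : ∀ Q → + 0 ≡ Q * Q * + 0 - Q * + 0 - Q * + 0 + + 0
      at-nil = solve-∀
    sumₗ-affine-product (x ∷ L) Q a b =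
      trans (cong (_+_ ((Q * a x - + 1) * (Q * b x - + 1))) (sumₗ-affine-product L Q a b))
            (regroup Q (a x) (b x) (sumₗ L (λ x → a x * b x)) (sumₗ L a) (sumₗ L b) (+ length L))
      where
      regroup : ∀ Q u v sab sa sb l → (Q * u - + 1) * (Q * v - + 1) + (Q * Q * sab - Q * sa - Q * sb + l) ≡
                                      Q * Q * (u * v + sab) - Q * (u + sa) - Q * (v + sb) + (+ 1 + l)
      regroup = solve-∀

    cauchy-schwarz : ∀ (L : List I) g → sumₗ L g * sumₗ L g ≤ + length L * sumₗ L (λ x → g x * g x)
    cauchy-schwarz []      g = ℤₚ.≤-refl
    cauchy-schwarz (x ∷ L) g = begin
      (g x + T) * (g x + T)
        ≡⟨ expand (g x) T ⟩
      g x * g x + + 2 * (g x * T) + T * T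
        ≤⟨ ℤₚ.+-mono-≤ (ℤₚ.+-monoʳ-≤ (g x * g x) (cross-term-≤ (g x) L)) (cauchy-schwarz L g) ⟩
      g x * g x + (l * (g x * g x) + T₂) + l * T₂
        ≡⟨ regroup (g x) l T₂ ⟩
      (+ 1 + l) * (g x * g x + T₂) ∎
      where
      open ℤₚ.≤-Reasoning
      T T₂ l : ℤ
      T  = sumₗ L g
      T₂ = sumₗ L (λ x → g x * g x)
      l  = + length L
      cross-term-≤ : ∀ a (M : List I) → + 2 * (a * sumₗ M g) ≤ + length M * (a * a) + sumₗ M (λ x → g x * g x)
      cross-term-≤ a []      = ℤₚ.≤-reflexive (at-nil a)
        where
        at-nil : ∀ a → + 2 * (a * + 0) ≡ + 0 * (a * a) + + 0
        at-nil = solve-∀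
      cross-term-≤ a (y ∷ M) = subst₂ _≤_ (regroupˡ a (g y) (sumₗ M g)) (regroupʳ a (g y) (+ length M) _)
                                      (ℤₚ.+-mono-≤ (2*i*j≤i*i+j*j a (g y)) (cross-term-≤ a M))
        where
        regroupˡ : ∀ a b s → + 2 * (a * b) + + 2 * (a * s) ≡ + 2 * (a * (b + s))
        regroupˡ = solve-∀
        regroupʳ : ∀ a b l t → (a * a + b * b) + (l * (a * a) + t) ≡ (+ 1 + l) * (a * a) + (b * b + t)
        regroupʳ = solve-∀
      expand : ∀ a t → (a + t) * (a + t) ≡ a * a + + 2 * (a * t) + t * t
      expand = solve-∀
      regroup : ∀ a l t → a * a + (l * (a * a) + t) + l * t ≡ (+ 1 + l) * (a * a + t)
      regroup = solve-∀

    sumₗ-nonneg : ∀ (L : List I) {f} → (∀ x → + 0 ≤ f x) → + 0 ≤ sumₗ L f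
    sumₗ-nonneg []      _     = ℤₚ.≤-refl
    sumₗ-nonneg (x ∷ L) f≥0 = ℤₚ.+-mono-≤ (f≥0 x) (sumₗ-nonneg L f≥0)

    sumₗ-⊆ : ∀ {L M : List I} {f} → (∀ x → + 0 ≤ f x) → Unique L → (∀ {x} → x ∈ L → x ∈ M) →
             sumₗ L f ≤ sumₗ M f
    sumₗ-⊆ {[]}    {M}     f≥0 _            _   = sumₗ-nonneg M f≥0
    sumₗ-⊆ {x ∷ L} {M} {f} f≥0 (x∉L ∷ uniq) L⊆M with ∈-∃++ (L⊆M (here refl))
    ... | M₁ , M₂ , refl = begin
      f x + sumₗ L f                ≤⟨ ℤₚ.+-monoʳ-≤ (f x) (sumₗ-⊆ f≥0 uniq L⊆M₁++M₂) ⟩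
      f x + sumₗ (M₁ ++ M₂) f       ≡⟨ cong (_+_ (f x)) (sumₗ-++ M₁ M₂ f) ⟩
      f x + (sumₗ M₁ f + sumₗ M₂ f) ≡⟨ swap (f x) (sumₗ M₁ f) (sumₗ M₂ f) ⟩
      sumₗ M₁ f + (f x + sumₗ M₂ f) ≡⟨ sumₗ-++ M₁ (x ∷ M₂) f ⟨
      sumₗ (M₁ ++ x ∷ M₂) f         ∎
      where
      open ℤₚ.≤-Reasoning
      swap : ∀ a b c → a + (b + c) ≡ b + (a + c)
      swap = solve-∀
      L⊆M₁++M₂ : ∀ {y} → y ∈ L → y ∈ M₁ ++ M₂
      L⊆M₁++M₂ {y} y∈L with ∈-++⁻ M₁ (L⊆M (there y∈L))
      ... | inj₁ y∈M₁         = ∈-++⁺ˡ y∈M₁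
      ... | inj₂ (here refl)  = contradiction refl (All.lookup x∉L y∈L)
      ... | inj₂ (there y∈M₂) = ∈-++⁺ʳ M₁ y∈M₂

module _ where
  open import Data.Nat using (_+_; _*_; _∸_; _≤_)
  open import Data.Nat.Tactic.RingSolver using (solve-∀)

  2*m*n≤m*m+n*n : ∀ m n → 2 * (m * n) ≤ m * m + n * n
  2*m*n≤m*m+n*n m n = [ ordered , flipped ]′ (ℕₚ.≤-total m n)
    where
    gap : ∀ a d → 2 * (a * (a + d)) + d * d ≡ a * a + (a + d) * (a + d)
    gap = solve-∀
    ordered : ∀ {a b} → a ≤ b → 2 * (a * b) ≤ a * a + b * b
    ordered {a} {b} a≤b = subst (λ b → 2 * (a * b) ≤ a * a + b * b) (ℕₚ.m+[n∸m]≡n a≤b)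
      (subst (2 * (a * (a + (b ∸ a))) ≤_) (gap a (b ∸ a)) (ℕₚ.m≤m+n _ _))
    flipped : n ≤ m → 2 * (m * n) ≤ m * m + n * n
    flipped n≤m = subst₂ _≤_ (cong (2 *_) (ℕₚ.*-comm n m)) (ℕₚ.+-comm (n * n) (m * m)) (ordered n≤m)

  s*s≤r*T⇒[s+m]*[s+m]≤[1+r]*[T+m*m] : ∀ r s m T → s * s ≤ r * T → (s + m) * (s + m) ≤ suc r * (T + m * m)
  s*s≤r*T⇒[s+m]*[s+m]≤[1+r]*[T+m*m] zero s m T s*s≤0
    rewrite [ id , id ]′ (ℕₚ.m*n≡0⇒m≡0∨n≡0 s (ℕₚ.n≤0⇒n≡0 s*s≤0)) =
    ℕₚ.≤-trans (ℕₚ.m≤n+m (m * m) T) (ℕₚ.≤-reflexive (sym (ℕₚ.+-identityʳ _)))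
  s*s≤r*T⇒[s+m]*[s+m]≤[1+r]*[T+m*m] r@(suc _) s m T s*s≤r*T = ℕₚ.*-cancelˡ-≤ r (begin
    r * ((s + m) * (s + m))
      ≡⟨ expand r s m ⟩
    r * (s * s) + 2 * (s * (r * m)) + r * (m * m)
      ≤⟨ ℕₚ.+-monoˡ-≤ (r * (m * m)) (ℕₚ.+-monoʳ-≤ (r * (s * s)) (2*m*n≤m*m+n*n s (r * m))) ⟩
    r * (s * s) + (s * s + (r * m) * (r * m)) + r * (m * m)
      ≡⟨ regroup r s m ⟩
    suc r * (s * s) + r * (suc r * (m * m))
      ≤⟨ ℕₚ.+-monoˡ-≤ (r * (suc r * (m * m))) (ℕₚ.*-monoʳ-≤ (suc r) s*s≤r*T) ⟩
    suc r * (r * T) + r * (suc r * (m * m))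
      ≡⟨ factor r T m ⟩
    r * (suc r * (T + m * m)) ∎)
    where
    open ℕₚ.≤-Reasoning
    expand : ∀ r s m → r * ((s + m) * (s + m)) ≡ r * (s * s) + 2 * (s * (r * m)) + r * (m * m)
    expand = solve-∀
    regroup : ∀ r s m → r * (s * s) + (s * s + (r * m) * (r * m)) + r * (m * m) ≡ suc r * (s * s) + r * (suc r * (m * m))
    regroup = solve-∀
    factor : ∀ r T m → suc r * (r * T) + r * (suc r * (m * m)) ≡ r * (suc r * (T + m * m))
    factor = solve-∀

module CaroWei {V : Set} (_≟_ : DecidableEquality V)
               {E : Rel V 0ℓ} (E? : Decidable E) (E-sym : ∀ {x y} → E x y → E y x) where

  open ℕΣ
  open import Data.Nat using (_+_; _*_; _≤_)

  Closed : V → Pred V 0ℓ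
  Closed x y = x ≡ y ⊎ E x y

  closed? : ∀ x → Decidable₁ (Closed x)
  closed? x y = (x ≟ y) ⊎-dec E? x y

  degree : List V → V → ℕ
  degree L x = count (closed? x) L

  -- For E the orthogonality relation of a bilinear form this is literally FieldOps.Orthogonal-k2.
  NoIndependentSet : ℕ → List V → Set
  NoIndependentSet k L = (v : Fin k → V) → (∀ i → v i ∈ L) → (∀ i j → v i ≡ v j → i ≡ j) →
                         Σ (Fin k) λ i → Σ (Fin k) λ j → (i ≢ j) × E (v i) (v j)

  ∈-outside : ∀ {L v y} → y ∈ filter (∁? (closed? v)) L → y ∈ L × ¬ Closed v y
  ∈-outside {L} {v} = ∈-filter⁻ (∁? (closed? v)) {xs = L}

  NoIndependentSet-outside-closed : ∀ {r L v} → NoIndependentSet (suc (suc r)) L → v ∈ L →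
                                    NoIndependentSet (suc r) (filter (∁? (closed? v)) L)
  NoIndependentSet-outside-closed {L = L} {v} noI v∈L f f∈ f-inj
    with noI (v Vector.∷ f) (λ { zero → v∈L ; (suc i) → proj₁ (far i) }) injective
    where
    far : ∀ i → f i ∈ L × ¬ Closed v (f i)
    far i = ∈-outside (f∈ i)
    injective : ∀ i j → (v Vector.∷ f) i ≡ (v Vector.∷ f) j → i ≡ j
    injective zero    zero    _  = refl
    injective zero    (suc j) eq = contradiction (inj₁ eq) (proj₂ (far j))
    injective (suc i) zero    eq = contradiction (inj₁ (sym eq)) (proj₂ (far i))
    injective (suc i) (suc j) eq = cong suc (f-inj i j eq)
  ... | zero  , zero  , 0≢0 , _   = contradiction refl 0≢0
  ... | zero  , suc j , _   , vEf = contradiction (inj₂ vEf) (proj₂ (∈-outside {L} (f∈ j)))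
  ... | suc i , zero  , _   , fEv = contradiction (inj₂ (E-sym fEv)) (proj₂ (∈-outside {L} (f∈ i)))
  ... | suc i , suc j , i≢j , fEf = i , j , i≢j ∘ cong suc , fEf

  -- Greedy: delete a vertex v of minimum degree m with its closed neighbourhood (m vertices, each of degree
  -- ≥ m).  Adding v to an independent set of the rest keeps it independent, so the rest needs one vertex less.
  caroWei : ∀ r L → NoIndependentSet (suc r) L → length L * length L ≤ r * sumₗ L (degree L)
  caroWei r       []       _   = z≤n
  caroWei zero    (x ∷ _)  noI with noI (λ _ → x) (λ _ → here refl) (λ { zero zero _ → refl })
  ... | zero , zero , 0≢0 , _ = contradiction refl 0≢0
  caroWei (suc r) L@(x ∷ xs) noI = begin
    length L * length L
      ≡⟨ cong (λ l → l * l) length-L ⟩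
    (length far + m) * (length far + m)
      ≤⟨ s*s≤r*T⇒[s+m]*[s+m]≤[1+r]*[T+m*m] r (length far) m _ (caroWei r far noI-far) ⟩
    suc r * (sumₗ far (degree far) + m * m)
      ≤⟨ ℕₚ.*-monoʳ-≤ (suc r) degree-sum ⟩
    suc r * sumₗ L (degree L) ∎
    where
    open ℕₚ.≤-Reasoning
    v : V
    v = argmin (degree L) x xs
    v∈L : v ∈ L
    v∈L = [ (λ v≡x → here v≡x) , there ]′ (argmin-sel (degree L) x xs)
    v-minimal : ∀ {y} → y ∈ L → degree L v ≤ degree L y
    v-minimal (here refl)  = f[argmin]≤f[⊤] {f = degree L} x xs
    v-minimal (there y∈xs) = All.lookup (f[argmin]≤f[xs] {f = degree L} x xs) y∈xs
    near far : List V
    near = filter (closed? v) L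
    far  = filter (∁? (closed? v)) L
    m : ℕ
    m = degree L v
    noI-far : NoIndependentSet (suc r) far
    noI-far = NoIndependentSet-outside-closed noI v∈L
    length-L : length L ≡ length far + m
    length-L = trans (length≡length-filter+length-filter∁ (closed? v) L)
                     (trans (ℕₚ.+-comm (length near) _) (cong (length far +_) (length-filter≡count (closed? v) L)))
    degree-sum : sumₗ far (degree far) + m * m ≤ sumₗ L (degree L)
    degree-sum = begin
      sumₗ far (degree far) + m * m
        ≤⟨ ℕₚ.+-mono-≤ (sumₗ-mono far (λ _ → sumₗ-filter-≤ (∁? (closed? v)) L _))
                       (ℕₚ.≤-reflexive (cong (_* m) (sym (length-filter≡count (closed? v) L)))) ⟩
      sumₗ far (degree L) + length near * m
        ≤⟨ ℕₚ.+-monoʳ-≤ (sumₗ far (degree L)) (subst (_≤ sumₗ near (degree L)) (sumₗ-const near m)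
             (sumₗ-mono near (v-minimal ∘ proj₁ ∘ ∈-filter⁻ (closed? v)))) ⟩
      sumₗ far (degree L) + sumₗ near (degree L)
        ≡⟨ ℕₚ.+-comm (sumₗ far (degree L)) _ ⟩
      sumₗ near (degree L) + sumₗ far (degree L)
        ≡⟨ sumₗ-filter (closed? v) L (degree L) ⟨
      sumₗ L (degree L) ∎

module FieldProperties {q : ℕ} (F : FiniteField q) where

  open FiniteField F public
  open FieldOps F public

  commutativeRing : CommutativeRing 0ℓ 0ℓ
  commutativeRing = record { isCommutativeRing = isCommutativeRing }

  open CommutativeRing commutativeRing public
    using ( +-assoc; +-comm; +-identityˡ; +-identityʳ; -‿inverseˡ; -‿inverseʳ
          ; *-assoc; *-comm; *-identityˡ; *-identityʳ; zeroˡ; zeroʳ; distribˡ)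
  open import Algebra.Properties.Ring (CommutativeRing.ring commutativeRing) public
    using ( -0#≈0#; -‿injective; -‿distribˡ-*; -‿distribʳ-*; -‿+-comm; +-inverseʳ-unique
          ; x[y-z]≈xy-xz; x∙y⁻¹≈ε⇒x≈y)
  open import Algebra.Solver.Ring.NaturalCoefficients.Default (CommutativeRing.commutativeSemiring commutativeRing) public
    using (solve; _:=_; _:+_; _:*_)

  *-cancelˡ-nonzero : ∀ {a b c} → a ≢ 0# → a * b ≡ a * c → b ≡ c
  *-cancelˡ-nonzero {a} {b} {c} a≢0 ab≡ac with inverse a a≢0
  ... | a⁻¹ , a*a⁻¹≡1 = trans (sym (undo b)) (trans (cong (a⁻¹ *_) ab≡ac) (undo c))
    where
    undo : ∀ x → a⁻¹ * (a * x) ≡ x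
    undo x = begin
      a⁻¹ * (a * x) ≡⟨ *-assoc a⁻¹ a x ⟨
      a⁻¹ * a * x   ≡⟨ cong (_* x) (trans (*-comm a⁻¹ a) a*a⁻¹≡1) ⟩
      1# * x        ≡⟨ *-identityˡ x ⟩
      x             ∎
      where open ≡-Reasoning

  *-cancelʳ-nonzero : ∀ {a b c} → a ≢ 0# → b * a ≡ c * a → b ≡ c
  *-cancelʳ-nonzero {a} {b} {c} a≢0 ba≡ca = *-cancelˡ-nonzero a≢0 (trans (*-comm a b) (trans ba≡ca (*-comm c a)))

  x+y≡z⇒y≡z-x : ∀ {x y z} → x + y ≡ z → y ≡ z + - x
  x+y≡z⇒y≡z-x {x} {y} {z} x+y≡z = begin
    y             ≡⟨ +-identityˡ y ⟨
    0# + y        ≡⟨ cong (_+ y) (-‿inverseˡ x) ⟨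
    - x + x + y   ≡⟨ +-assoc (- x) x y ⟩
    - x + (x + y) ≡⟨ cong (- x +_) x+y≡z ⟩
    - x + z       ≡⟨ +-comm (- x) z ⟩
    z + - x       ∎
    where open ≡-Reasoning

  y≡z-x⇒x+y≡z : ∀ {x y z} → y ≡ z + - x → x + y ≡ z
  y≡z-x⇒x+y≡z {x} {y} {z} y≡z-x = begin
    x + y         ≡⟨ cong (x +_) (trans y≡z-x (+-comm z (- x))) ⟩
    x + (- x + z) ≡⟨ +-assoc x (- x) z ⟨
    x + - x + z   ≡⟨ cong (_+ z) (-‿inverseʳ x) ⟩
    0# + z        ≡⟨ +-identityˡ z ⟩
    z             ∎
    where open ≡-Reasoning

  ∑-cong : ∀ n {f g : Fin n → Carrier} → (∀ i → f i ≡ g i) → ∑ n f ≡ ∑ n g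
  ∑-cong zero    f≗g = refl
  ∑-cong (suc n) f≗g = cong₂ _+_ (f≗g zero) (∑-cong n (f≗g ∘ suc))

  ∑-zero : ∀ n {f : Fin n → Carrier} → (∀ i → f i ≡ 0#) → ∑ n f ≡ 0#
  ∑-zero zero    f≗0 = refl
  ∑-zero (suc n) f≗0 = trans (cong₂ _+_ (f≗0 zero) (∑-zero n (λ i → f≗0 (suc i)))) (+-identityˡ 0#)

  ∑-distrib-+ : ∀ n (f g : Fin n → Carrier) → ∑ n (λ i → f i + g i) ≡ ∑ n f + ∑ n g
  ∑-distrib-+ zero    f g = sym (+-identityˡ 0#)
  ∑-distrib-+ (suc n) f g = trans (cong (f zero + g zero +_) (∑-distrib-+ n (λ i → f (suc i)) (λ i → g (suc i))))
    (solve 4 (λ a b c d → (a :+ b) :+ (c :+ d) := (a :+ c) :+ (b :+ d)) refl _ _ _ _)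

  *-distribˡ-∑ : ∀ n a (f : Fin n → Carrier) → a * ∑ n f ≡ ∑ n (λ i → a * f i)
  *-distribˡ-∑ zero    a f = zeroʳ a
  *-distribˡ-∑ (suc n) a f = trans (distribˡ a (f zero) _) (cong (a * f zero +_) (*-distribˡ-∑ n a (λ i → f (suc i))))

  -‿distrib-∑ : ∀ n (f : Fin n → Carrier) → - ∑ n f ≡ ∑ n (λ i → - f i)
  -‿distrib-∑ zero    f = -0#≈0#
  -‿distrib-∑ (suc n) f = trans (sym (-‿+-comm (f zero) _)) (cong (- f zero +_) (-‿distrib-∑ n (λ i → f (suc i))))

  ∑-comm : ∀ m n (f : Fin m → Fin n → Carrier) →
           ∑ m (λ i → ∑ n (f i)) ≡ ∑ n (λ j → ∑ m (λ i → f i j))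
  ∑-comm zero    n f = sym (∑-zero n (λ _ → refl))
  ∑-comm (suc m) n f = trans (cong (∑ n (f zero) +_) (∑-comm m n (λ i → f (suc i))))
                             (sym (∑-distrib-+ n (f zero) (λ j → ∑ m (λ i → f (suc i) j))))

  ∑-single : ∀ n (c : Fin n) (f : Fin n → Carrier) → (∀ k → k ≢ c → f k ≡ 0#) → ∑ n f ≡ f c
  ∑-single (suc n) zero    f off = trans (cong (f zero +_) (∑-zero n (λ i → off (suc i) λ ()))) (+-identityʳ _)
  ∑-single (suc n) (suc c) f off =
    trans (cong₂ _+_ (off zero λ ()) (∑-single n c (f ∘ suc) λ k k≢c → off (suc k) (k≢c ∘ suc-injective)))
          (+-identityˡ _)

data Adjacent : ∀ {m} → Fin m → Fin m → Set where
  zero-one : ∀ {m} → Adjacent {suc (suc m)} zero (suc zero)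
  suc-suc  : ∀ {m} {i j : Fin (suc m)} → Adjacent i j → Adjacent {suc (suc m)} (suc i) (suc j)

Adjacent⇒toℕ : ∀ {m} {i j : Fin m} → Adjacent i j → toℕ j ≡ suc (toℕ i)
Adjacent⇒toℕ zero-one      = refl
Adjacent⇒toℕ (suc-suc adj) = cong suc (Adjacent⇒toℕ adj)

Adjacent⇒≢ : ∀ {m} {i j : Fin m} → Adjacent i j → i ≢ j
Adjacent⇒≢ adj refl = ℕₚ.1+n≢n (sym (Adjacent⇒toℕ adj))

Adjacent-inject₁ : ∀ {m} (j : Fin m) → Adjacent (inject₁ j) (suc j)
Adjacent-inject₁ zero    = zero-one
Adjacent-inject₁ (suc j) = suc-suc (Adjacent-inject₁ j)

Adjacent-punchOut : ∀ {n} {i j k : Fin (suc n)} → Adjacent i j → (k≢i : k ≢ i) (k≢j : k ≢ j) →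
                    Adjacent (punchOut k≢i) (punchOut k≢j)
Adjacent-punchOut {k = zero}       zero-one      k≢i _   = contradiction refl k≢i
Adjacent-punchOut {k = suc zero}   zero-one      _   k≢j = contradiction refl k≢j
Adjacent-punchOut {suc (suc n)} {k = suc (suc k)} zero-one _ _ = zero-one
Adjacent-punchOut {k = zero}       (suc-suc adj) _   _   = adj
Adjacent-punchOut {suc (suc n)} {k = suc k} (suc-suc adj) k≢i k≢j =
  suc-suc (Adjacent-punchOut adj (k≢i ∘ cong suc) (k≢j ∘ cong suc))

Adjacent-punchIn : ∀ {n} {i j : Fin (suc n)} → Adjacent i j → ∀ c →
                   punchIn i c ≡ punchIn j c ⊎ (punchIn i c ≡ j × punchIn j c ≡ i)
Adjacent-punchIn zero-one      zero    = inj₂ (refl , refl)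
Adjacent-punchIn zero-one      (suc c) = inj₁ refl
Adjacent-punchIn (suc-suc adj) zero    = inj₁ refl
Adjacent-punchIn (suc-suc adj) (suc c) with Adjacent-punchIn adj c
... | inj₁ eq          = inj₁ (cong suc eq)
... | inj₂ (eq₁ , eq₂) = inj₂ (cong suc eq₁ , cong suc eq₂)

toℕ-gap : ∀ {n} {i j : Fin n} → toℕ i ℕ.< toℕ j → toℕ j ≡ suc ((toℕ j ℕ.∸ suc (toℕ i)) ℕ.+ toℕ i)
toℕ-gap {i = i} {j} i<j = sym (trans (sym (ℕₚ.+-suc (toℕ j ℕ.∸ suc (toℕ i)) (toℕ i))) (ℕₚ.m∸n+n≡m i<j))

module Determinant {q : ℕ} (F : FiniteField q) where

  open FieldProperties F

  Matrix : ℕ → Set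
  Matrix n = Fin n → Fin n → Carrier

  minor : ∀ {n} → Matrix (suc n) → Fin (suc n) → Matrix n
  minor A j r c = A (suc r) (punchIn j c)

  expansionTerm : ∀ {n} → Matrix (suc n) → Fin (suc n) → Carrier
  expansionTerm {n} A j = sgn (toℕ j) * A zero j * det n (minor A j)

  det-cong : ∀ n {A B : Matrix n} → (∀ r c → A r c ≡ B r c) → det n A ≡ det n B
  det-cong zero    _   = refl
  det-cong (suc n) A≗B = ∑-cong (suc n) λ j →
    cong₂ (λ a d → sgn (toℕ j) * a * d) (A≗B zero j) (det-cong n λ r c → A≗B (suc r) (punchIn j c))

  det-linear-in-column : ∀ n (c : Fin n) {A B C : Matrix n} a b →
    (∀ r k → k ≢ c → A r k ≡ B r k) → (∀ r k → k ≢ c → A r k ≡ C r k) →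
    (∀ r → A r c ≡ a * B r c + b * C r c) → det n A ≡ a * det n B + b * det n C
  det-linear-in-column (suc n) c {A} {B} {C} a b A≈B A≈C A-c = begin
    ∑ (suc n) (expansionTerm A)
      ≡⟨ ∑-cong (suc n) linear-term ⟩
    ∑ (suc n) (λ j → a * expansionTerm B j + b * expansionTerm C j)
      ≡⟨ ∑-distrib-+ (suc n) (λ j → a * expansionTerm B j) (λ j → b * expansionTerm C j) ⟩
    ∑ (suc n) (λ j → a * expansionTerm B j) + ∑ (suc n) (λ j → b * expansionTerm C j)
      ≡⟨ cong₂ _+_ (*-distribˡ-∑ (suc n) a (expansionTerm B)) (*-distribˡ-∑ (suc n) b (expansionTerm C)) ⟨
    a * det (suc n) B + b * det (suc n) C ∎
    where
    open ≡-Reasoning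
    linear-term : ∀ j → expansionTerm A j ≡ a * expansionTerm B j + b * expansionTerm C j
    linear-term j with j Finₚ.≟ c
    ... | yes refl = begin
      sgn (toℕ j) * A zero j * det n (minor A j)
        ≡⟨ cong (λ x → sgn (toℕ j) * x * det n (minor A j)) (A-c zero) ⟩
      sgn (toℕ j) * (a * B zero j + b * C zero j) * det n (minor A j)
        ≡⟨ solve 6 (λ s a x b y d → s :* (a :* x :+ b :* y) :* d := a :* (s :* x :* d) :+ b :* (s :* y :* d))
                 refl (sgn (toℕ j)) a (B zero j) b (C zero j) (det n (minor A j)) ⟩
      a * (sgn (toℕ j) * B zero j * det n (minor A j)) + b * (sgn (toℕ j) * C zero j * det n (minor A j))
        ≡⟨ cong₂ (λ d d′ → a * (sgn (toℕ j) * B zero j * d) + b * (sgn (toℕ j) * C zero j * d′))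
                 (det-cong n λ r k → A≈B (suc r) _ (punchInᵢ≢i j k))
                 (det-cong n λ r k → A≈C (suc r) _ (punchInᵢ≢i j k)) ⟩
      a * expansionTerm B j + b * expansionTerm C j ∎
    ... | no j≢c = begin
      sgn (toℕ j) * A zero j * det n (minor A j)
        ≡⟨ cong (sgn (toℕ j) * A zero j *_) minor-linear ⟩
      sgn (toℕ j) * A zero j * (a * det n (minor B j) + b * det n (minor C j))
        ≡⟨ solve 6 (λ s x a d b d′ → s :* x :* (a :* d :+ b :* d′) := a :* (s :* x :* d) :+ b :* (s :* x :* d′))
                 refl (sgn (toℕ j)) (A zero j) a (det n (minor B j)) b (det n (minor C j)) ⟩
      a * (sgn (toℕ j) * A zero j * det n (minor B j)) + b * (sgn (toℕ j) * A zero j * det n (minor C j))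
        ≡⟨ cong₂ (λ x y → a * (sgn (toℕ j) * x * det n (minor B j)) + b * (sgn (toℕ j) * y * det n (minor C j)))
                 (A≈B zero j j≢c) (A≈C zero j j≢c) ⟩
      a * expansionTerm B j + b * expansionTerm C j ∎
      where
      c′ : Fin n
      c′ = punchOut j≢c
      off-c′ : ∀ k → k ≢ c′ → punchIn j k ≢ c
      off-c′ k k≢c′ eq = k≢c′ (punchIn-injective j k c′ (trans eq (sym (punchIn-punchOut j≢c))))
      minor-linear : det n (minor A j) ≡ a * det n (minor B j) + b * det n (minor C j)
      minor-linear = det-linear-in-column n c′ a b
        (λ r k k≢c′ → A≈B (suc r) _ (off-c′ k k≢c′)) (λ r k k≢c′ → A≈C (suc r) _ (off-c′ k k≢c′))
        (λ r → subst (λ t → A (suc r) t ≡ a * B (suc r) t + b * C (suc r) t)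
                     (sym (punchIn-punchOut j≢c)) (A-c (suc r)))

  det-additive-in-column : ∀ n (c : Fin n) {A B C : Matrix n} →
    (∀ r k → k ≢ c → A r k ≡ B r k) → (∀ r k → k ≢ c → A r k ≡ C r k) →
    (∀ r → A r c ≡ B r c + C r c) → det n A ≡ det n B + det n C
  det-additive-in-column n c {A} {B} {C} A≈B A≈C A-c =
    trans (det-linear-in-column n c 1# 1# A≈B A≈C λ r → trans (A-c r) (sym (cong₂ _+_ (*-identityˡ _) (*-identityˡ _))))
          (cong₂ _+_ (*-identityˡ _) (*-identityˡ _))

  ∑-adjacent-cancel : ∀ {m} {i j : Fin m} (f : Fin m → Carrier) → Adjacent i j →
                      (∀ k → k ≢ i → k ≢ j → f k ≡ 0#) → f j ≡ - f i → ∑ m f ≡ 0#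
  ∑-adjacent-cancel {suc (suc m)} f zero-one f-off f₁≡-f₀ = begin
    f zero + (f (suc zero) + ∑ m (λ k → f (suc (suc k))))
      ≡⟨ cong₂ (λ x y → f zero + (x + y)) f₁≡-f₀ (∑-zero m λ k → f-off (suc (suc k)) (λ ()) (λ ())) ⟩
    f zero + (- f zero + 0#)
      ≡⟨ cong (f zero +_) (+-identityʳ (- f zero)) ⟩
    f zero + - f zero
      ≡⟨ -‿inverseʳ (f zero) ⟩
    0# ∎
    where open ≡-Reasoning
  ∑-adjacent-cancel {suc (suc m)} {suc i} {suc j} f (suc-suc adj) f-off fj≡-fi =
    trans (cong₂ _+_ (f-off zero (λ ()) (λ ())) (∑-adjacent-cancel (f ∘ suc) adj f∘suc-off fj≡-fi)) (+-identityˡ 0#)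
    where
    f∘suc-off : ∀ k → k ≢ i → k ≢ j → f (suc k) ≡ 0#
    f∘suc-off k k≢i k≢j = f-off (suc k) (k≢i ∘ suc-injective) (k≢j ∘ suc-injective)

  det-adjacent-equal-columns : ∀ n (A : Matrix n) {i j} → Adjacent i j → (∀ r → A r i ≡ A r j) → det n A ≡ 0#
  det-adjacent-equal-columns (suc n) A {i} {j} adj Ai≡Aj = ∑-adjacent-cancel (expansionTerm A) adj other-term paired-term
    where
    other-term : ∀ k → k ≢ i → k ≢ j → expansionTerm A k ≡ 0#
    other-term k k≢i k≢j = trans (cong (sgn (toℕ k) * A zero k *_) minor-vanishes) (zeroʳ _)
      where
      minor-vanishes : det n (minor A k) ≡ 0#
      minor-vanishes = det-adjacent-equal-columns n (minor A k) (Adjacent-punchOut adj k≢i k≢j) λ r →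
        trans (cong (A (suc r)) (punchIn-punchOut k≢i))
            (trans (Ai≡Aj (suc r)) (cong (A (suc r)) (sym (punchIn-punchOut k≢j))))
    same-minor : ∀ r c → minor A j r c ≡ minor A i r c
    same-minor r c with Adjacent-punchIn adj c
    ... | inj₁ eq          = cong (A (suc r)) (sym eq)
    ... | inj₂ (eq₁ , eq₂) = trans (cong (A (suc r)) eq₂) (trans (Ai≡Aj (suc r)) (cong (A (suc r)) (sym eq₁)))
    paired-term : expansionTerm A j ≡ - expansionTerm A i
    paired-term = begin
      sgn (toℕ j) * A zero j * det n (minor A j)
        ≡⟨ cong₂ (λ s x → s * x * det n (minor A j)) (cong sgn (Adjacent⇒toℕ adj)) (sym (Ai≡Aj zero)) ⟩
      - sgn (toℕ i) * A zero i * det n (minor A j)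
        ≡⟨ cong (- sgn (toℕ i) * A zero i *_) (det-cong n same-minor) ⟩
      - sgn (toℕ i) * A zero i * det n (minor A i)
        ≡⟨ cong (_* det n (minor A i)) (-‿distribˡ-* (sgn (toℕ i)) (A zero i)) ⟨
      - (sgn (toℕ i) * A zero i) * det n (minor A i)
        ≡⟨ -‿distribˡ-* (sgn (toℕ i) * A zero i) (det n (minor A i)) ⟨
      - expansionTerm A i ∎
      where open ≡-Reasoning

  setColumns : ∀ {n} → Matrix n → (i j : Fin n) → (u v : Fin n → Carrier) → Matrix n
  setColumns A i j u v r k with k Finₚ.≟ i | k Finₚ.≟ j
  ... | yes _ | _     = u r
  ... | no  _ | yes _ = v r
  ... | no  _ | no  _ = A r k

  setColumns-char : ∀ {n} {A B : Matrix n} {i j u v} → (∀ r → B r i ≡ u r) → (∀ r → B r j ≡ v r) →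
                    (∀ r k → k ≢ i → k ≢ j → B r k ≡ A r k) → ∀ r k → setColumns A i j u v r k ≡ B r k
  setColumns-char {i = i} {j} Bi Bj Bk r k with k Finₚ.≟ i | k Finₚ.≟ j
  ... | yes refl | _        = sym (Bi r)
  ... | no  _    | yes refl = sym (Bj r)
  ... | no  k≢i  | no  k≢j  = sym (Bk r k k≢i k≢j)

  module _ {n} (A : Matrix n) {i j : Fin n} (i≢j : i ≢ j) (u v : Fin n → Carrier) where

    setColumns-i : ∀ r → setColumns A i j u v r i ≡ u r
    setColumns-i r with i Finₚ.≟ i
    ... | yes _   = refl
    ... | no  i≢i = contradiction refl i≢i

    setColumns-j : ∀ r → setColumns A i j u v r j ≡ v r
    setColumns-j r with j Finₚ.≟ i | j Finₚ.≟ j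
    ... | yes j≡i | _       = contradiction (sym j≡i) i≢j
    ... | no  _   | yes _   = refl
    ... | no  _   | no  j≢j = contradiction refl j≢j

    setColumns-other : ∀ r k → k ≢ i → k ≢ j → setColumns A i j u v r k ≡ A r k
    setColumns-other r k k≢i k≢j with k Finₚ.≟ i | k Finₚ.≟ j
    ... | yes k≡i | _       = contradiction k≡i k≢i
    ... | no  _   | yes k≡j = contradiction k≡j k≢j
    ... | no  _   | no  _   = refl

  setColumns-off-i : ∀ {n} (A : Matrix n) {i j u u′ v} r k → k ≢ i →
                     setColumns A i j u v r k ≡ setColumns A i j u′ v r k
  setColumns-off-i A {i} {j} r k k≢i with k Finₚ.≟ i | k Finₚ.≟ j
  ... | yes k≡i | _     = contradiction k≡i k≢i
  ... | no  _   | yes _ = refl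
  ... | no  _   | no  _ = refl

  setColumns-off-j : ∀ {n} (A : Matrix n) {i j u v v′} r k → k ≢ j →
                     setColumns A i j u v r k ≡ setColumns A i j u v′ r k
  setColumns-off-j A {i} {j} r k k≢j with k Finₚ.≟ i | k Finₚ.≟ j
  ... | yes _ | _       = refl
  ... | no  _ | yes k≡j = contradiction k≡j k≢j
  ... | no  _ | no  _   = refl

  setColumn : ∀ {n} → Matrix n → Fin n → (Fin n → Carrier) → Matrix n
  setColumn A c v r = Vector.updateAt (A r) c (λ _ → v r)

  setColumn-same : ∀ {n} (A : Matrix n) {c} v r → setColumn A c v r c ≡ v r
  setColumn-same A {c} v r = updateAt-updates c (A r)

  setColumn-other : ∀ {n} (A : Matrix n) {c} v r {k} → k ≢ c → setColumn A c v r k ≡ A r k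
  setColumn-other A {c} v r {k} k≢c = updateAt-minimal k c (A r) k≢c

  column : ∀ {n} → Matrix n → Fin n → Fin n → Carrier
  column A k r = A r k

  swapColumns : ∀ {n} → Matrix n → Fin n → Fin n → Matrix n
  swapColumns A i j = setColumns A i j (column A j) (column A i)

  det-swap-adjacent : ∀ n (A : Matrix n) {i j} → Adjacent i j → det n (swapColumns A i j) ≡ - det n A
  det-swap-adjacent n A {i} {j} adj = +-inverseʳ-unique (det n A) _ (begin
    det n A + det n (swapColumns A i j)
      ≡⟨ cong (_+ D b a) (det-cong n (setColumns-char (λ _ → refl) (λ _ → refl) (λ _ _ _ _ → refl))) ⟨
    D a b + D b a
      ≡⟨ cong₂ _+_ (+-identityˡ _) (+-identityʳ _) ⟨
    (0# + D a b) + (D b a + 0#)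
      ≡⟨ cong₂ (λ x y → (x + D a b) + (D b a + y)) (D-diag a) (D-diag b) ⟨
    (D a a + D a b) + (D b a + D b b)
      ≡⟨ cong₂ _+_ (D-additiveʳ a a b) (D-additiveʳ b a b) ⟨
    D a (λ r → a r + b r) + D b (λ r → a r + b r)
      ≡⟨ D-additiveˡ a b _ ⟨
    D (λ r → a r + b r) (λ r → a r + b r)
      ≡⟨ D-diag _ ⟩
    0# ∎)
    where
    open ≡-Reasoning
    i≢j : i ≢ j
    i≢j = Adjacent⇒≢ adj
    a b : Fin n → Carrier
    a = column A i
    b = column A j
    D : (Fin n → Carrier) → (Fin n → Carrier) → Carrier
    D u v = det n (setColumns A i j u v)
    D-diag : ∀ u → D u u ≡ 0#
    D-diag u = det-adjacent-equal-columns n _ adj λ r → trans (setColumns-i A i≢j u u r) (sym (setColumns-j A i≢j u u r))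
    D-additiveˡ : ∀ u u′ v → D (λ r → u r + u′ r) v ≡ D u v + D u′ v
    D-additiveˡ u u′ v = det-additive-in-column n i
      (λ r k → setColumns-off-i A r k) (λ r k → setColumns-off-i A r k)
      (λ r → trans (setColumns-i A i≢j _ v r)
                   (sym (cong₂ _+_ (setColumns-i A i≢j u v r) (setColumns-i A i≢j u′ v r))))
    D-additiveʳ : ∀ u v v′ → D u (λ r → v r + v′ r) ≡ D u v + D u v′
    D-additiveʳ u v v′ = det-additive-in-column n j
      (λ r k → setColumns-off-j A r k) (λ r k → setColumns-off-j A r k)
      (λ r → trans (setColumns-j A i≢j u _ r)
                   (sym (cong₂ _+_ (setColumns-j A i≢j u v r) (setColumns-j A i≢j u v′ r))))

  -- Swapping the adjacent columns j − 1 and j moves the copy of column i one step closer to it.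
  det-equal-columns-apart : ∀ d n (A : Matrix n) (i j : Fin n) → toℕ j ≡ suc (d ℕ.+ toℕ i) →
                            (∀ r → A r i ≡ A r j) → det n A ≡ 0#
  det-equal-columns-apart d       (suc n) A i zero    ()
  det-equal-columns-apart zero    (suc n) A i (suc j) j≡1+i Ai≡Aj =
    det-adjacent-equal-columns (suc n) A (subst (λ k → Adjacent k (suc j)) j′≡i (Adjacent-inject₁ j)) Ai≡Aj
    where
    j′≡i : inject₁ j ≡ i
    j′≡i = toℕ-injective (trans (toℕ-inject₁ j) (ℕₚ.suc-injective j≡1+i))
  det-equal-columns-apart (suc d) (suc n) A i (suc j) j≡2+d+i Ai≡Aj =
    -‿injective (trans (sym (det-swap-adjacent (suc n) A adj)) (trans swapped-vanishes (sym -0#≈0#)))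
    where
    j′ : Fin (suc n)
    j′ = inject₁ j
    adj : Adjacent j′ (suc j)
    adj = Adjacent-inject₁ j
    j′≡1+d+i : toℕ j′ ≡ suc (d ℕ.+ toℕ i)
    j′≡1+d+i = trans (toℕ-inject₁ j) (ℕₚ.suc-injective j≡2+d+i)
    i≢j′ : i ≢ j′
    i≢j′ i≡j′ = ℕₚ.m≢1+n+m (toℕ i) (trans (cong toℕ i≡j′) j′≡1+d+i)
    i≢j : i ≢ suc j
    i≢j i≡j = ℕₚ.m≢1+n+m (toℕ i) (trans (cong toℕ i≡j) j≡2+d+i)
    swapped-vanishes : det (suc n) (swapColumns A j′ (suc j)) ≡ 0#
    swapped-vanishes = det-equal-columns-apart d (suc n) (swapColumns A j′ (suc j)) i j′ j′≡1+d+i λ r →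
      trans (setColumns-other A (Adjacent⇒≢ adj) _ _ r i i≢j′ i≢j)
            (trans (Ai≡Aj r) (sym (setColumns-i A (Adjacent⇒≢ adj) _ _ r)))

  det-equal-columns : ∀ n (A : Matrix n) {i j : Fin n} → i ≢ j → (∀ r → A r i ≡ A r j) → det n A ≡ 0#
  det-equal-columns n A {i} {j} i≢j Ai≡Aj with Finₚ.<-cmp i j
  ... | tri< i<j _ _ = det-equal-columns-apart _ n A i j (toℕ-gap i<j) Ai≡Aj
  ... | tri≈ _ i≡j _ = contradiction i≡j i≢j
  ... | tri> _ _ j<i = det-equal-columns-apart _ n A j i (toℕ-gap j<i) (sym ∘ Ai≡Aj)

  module _ {n} (A : Matrix n) (c : Fin n) where

    private
      D : (Fin n → Carrier) → Carrier
      D v = det n (setColumn A c v)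

    det-setColumn-cong : ∀ {u v} → (∀ r → u r ≡ v r) → D u ≡ D v
    det-setColumn-cong u≗v = det-cong n λ r k → updateAt-cong-local c (A r) (u≗v r) k

    det-setColumn-linear : ∀ a b u v → D (λ r → a * u r + b * v r) ≡ a * D u + b * D v
    det-setColumn-linear a b u v = det-linear-in-column n c a b
      (λ r k k≢c → trans (setColumn-other A w r k≢c) (sym (setColumn-other A u r k≢c)))
      (λ r k k≢c → trans (setColumn-other A w r k≢c) (sym (setColumn-other A v r k≢c)))
      (λ r → trans (setColumn-same A w r)
                   (sym (cong₂ (λ x y → a * x + b * y) (setColumn-same A u r) (setColumn-same A v r))))
      where
      w : Fin n → Carrier
      w r = a * u r + b * v r

    det-setColumn-zero : D (λ _ → 0#) ≡ 0#
    det-setColumn-zero = begin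
      D (λ _ → 0#)
        ≡⟨ det-setColumn-cong (λ _ → trans (sym (+-identityˡ 0#)) (sym (cong₂ _+_ (zeroˡ 0#) (zeroˡ 0#)))) ⟩
      D (λ _ → 0# * 0# + 0# * 0#)
        ≡⟨ det-setColumn-linear 0# 0# _ _ ⟩
      0# * D (λ _ → 0#) + 0# * D (λ _ → 0#)
        ≡⟨ cong₂ _+_ (zeroˡ _) (zeroˡ _) ⟩
      0# + 0#
        ≡⟨ +-identityˡ 0# ⟩
      0# ∎
      where open ≡-Reasoning

    det-setColumn-∑ : ∀ m (y : Fin m → Carrier) (g : Fin m → Fin n → Carrier) →
                      D (λ r → ∑ m (λ k → y k * g k r)) ≡ ∑ m (λ k → y k * D (g k))
    det-setColumn-∑ zero    y g = det-setColumn-zero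
    det-setColumn-∑ (suc m) y g = begin
      D (λ r → y zero * g zero r + ∑ m (λ k → y (suc k) * g (suc k) r))
        ≡⟨ det-setColumn-cong (λ r → cong (y zero * g zero r +_) (sym (*-identityˡ _))) ⟩
      D (λ r → y zero * g zero r + 1# * ∑ m (λ k → y (suc k) * g (suc k) r))
        ≡⟨ det-setColumn-linear (y zero) 1# (g zero) _ ⟩
      y zero * D (g zero) + 1# * D (λ r → ∑ m (λ k → y (suc k) * g (suc k) r))
        ≡⟨ cong (y zero * D (g zero) +_) (trans (*-identityˡ _) (det-setColumn-∑ m (y ∘ suc) (g ∘ suc))) ⟩
      y zero * D (g zero) + ∑ m (λ k → y (suc k) * D (g (suc k))) ∎
      where open ≡-Reasoning

    det-setColumn-other-column : ∀ {k} → k ≢ c → D (column A k) ≡ 0#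
    det-setColumn-other-column {k} k≢c = det-equal-columns n _ (k≢c ∘ sym) λ r →
      trans (setColumn-same A (column A k) r) (sym (setColumn-other A (column A k) r k≢c))

    det-setColumn-own-column : D (column A c) ≡ det n A
    det-setColumn-own-column = det-cong n λ r k → updateAt-id-local c (A r) refl k

  -- By multilinearity in column c, replacing column c by A x = 0 gives a determinant equal to x c · det A.
  nonzero-kernel⇒det≡0 : ∀ n (A : Matrix n) (x : Fin n → Carrier) →
                         (∀ r → ∑ n (λ k → A r k * x k) ≡ 0#) →
                         ∀ c → x c ≢ 0# → det n A ≡ 0#
  nonzero-kernel⇒det≡0 n A x Ax≡0 c xc≢0 = *-cancelˡ-nonzero xc≢0 (trans (begin
    x c * det n A
      ≡⟨ cong (x c *_) (det-setColumn-own-column A c) ⟨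
    x c * D (column A c)
      ≡⟨ ∑-single n c _ (λ k k≢c → trans (cong (x k *_) (det-setColumn-other-column A c k≢c)) (zeroʳ _)) ⟨
    ∑ n (λ k → x k * D (column A k))
      ≡⟨ det-setColumn-∑ A c n x (column A) ⟨
    D (λ r → ∑ n (λ k → x k * A r k))
      ≡⟨ det-setColumn-cong A c (λ r → trans (∑-cong n λ k → *-comm (x k) (A r k)) (Ax≡0 r)) ⟩
    D (λ _ → 0#)
      ≡⟨ det-setColumn-zero A c ⟩
    0# ∎) (sym (zeroʳ (x c))))
    where
    open ≡-Reasoning
    D : (Fin n → Carrier) → Carrier
    D v = det n (setColumn A c v)

module Vectors {q : ℕ} (F : FiniteField q) where

  open FieldProperties F
  open ℕΣ

  elements : List Carrier
  elements = List.tabulate (Inverse.from card)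

  ∈-elements : ∀ x → x ∈ elements
  ∈-elements x = subst (_∈ elements) (Inverse.strictlyInverseʳ card x) (∈-tabulate⁺ (Inverse.to card x))

  elements-unique : Unique elements
  elements-unique = tabulate⁺ λ {i} {j} eq →
    trans (sym (Inverse.strictlyInverseˡ card i)) (trans (cong (Inverse.to card) eq) (Inverse.strictlyInverseˡ card j))

  sumₗ-elements-const : ∀ k → sumₗ elements (λ _ → k) ≡ q ℕ.* k
  sumₗ-elements-const k = trans (sumₗ-const elements k) (cong (ℕ._* k) (length-tabulate (Inverse.from card)))

  zeros : ∀ n → Vec Carrier n
  zeros n = replicate n 0#

  infix 4 _≟ᵥ_
  _≟ᵥ_ : ∀ {n} → DecidableEquality (Vec Carrier n)
  _≟ᵥ_ = Vecₚ.≡-dec _≟_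

  vectors : ∀ n → List (Vec Carrier n)
  vectors zero    = [ [] ]
  vectors (suc n) = concatMap (λ c → map (c ∷_) (vectors n)) elements

  ∈-vectors : ∀ {n} (v : Vec Carrier n) → v ∈ vectors n
  ∈-vectors []      = here refl
  ∈-vectors (c ∷ v) =
    ∈-concatMap⁺ (λ c → map (c ∷_) (vectors _)) (lose (∈-elements c) (∈-map⁺ (c ∷_) (∈-vectors v)))

  sumₗ-vectors : ∀ n (f : Vec Carrier (suc n) → ℕ) →
                 sumₗ (vectors (suc n)) f ≡ sumₗ elements (λ c → sumₗ (vectors n) (λ v → f (c ∷ v)))
  sumₗ-vectors n f =
    trans (sumₗ-concatMap _ elements f) (sumₗ-cong elements λ {c} _ → sumₗ-map (c ∷_) (vectors n) f)

  sumₗ-vectors-const : ∀ n k → sumₗ (vectors n) (λ _ → k) ≡ q ℕ.^ n ℕ.* k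
  sumₗ-vectors-const zero    k = refl
  sumₗ-vectors-const (suc n) k = begin
    sumₗ (vectors (suc n)) (λ _ → k)                    ≡⟨ sumₗ-vectors n (λ _ → k) ⟩
    sumₗ elements (λ _ → sumₗ (vectors n) (λ _ → k))     ≡⟨ sumₗ-elements-const _ ⟩
    q ℕ.* sumₗ (vectors n) (λ _ → k)                    ≡⟨ cong (q ℕ.*_) (sumₗ-vectors-const n k) ⟩
    q ℕ.* (q ℕ.^ n ℕ.* k)                               ≡⟨ ℕₚ.*-assoc q _ k ⟨
    q ℕ.^ suc n ℕ.* k                                   ∎
    where open ≡-Reasoning

  length-vectors : ∀ n → length (vectors n) ≡ q ℕ.^ n
  length-vectors n = trans (sym (trans (sumₗ-const (vectors n) 1) (ℕₚ.*-identityʳ _)))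
                           (trans (sumₗ-vectors-const n 1) (ℕₚ.*-identityʳ _))

  infix 8 _·ᵥ_
  infixl 7 _+ᵥ_ _∙_

  _∙_ : ∀ {n} → Vec Carrier n → Vec Carrier n → Carrier
  _∙_ {n} x w = ∑ n (λ i → lookup x i * lookup w i)

  _·ᵥ_ : ∀ {n} → Carrier → Vec Carrier n → Vec Carrier n
  α ·ᵥ w = Vec.map (α *_) w

  _+ᵥ_ : ∀ {n} → Vec Carrier n → Vec Carrier n → Vec Carrier n
  _+ᵥ_ = zipWith _+_

  ∙-zerosʳ : ∀ {n} (x : Vec Carrier n) → x ∙ zeros n ≡ 0#
  ∙-zerosʳ []      = refl
  ∙-zerosʳ (c ∷ x) = trans (cong₂ _+_ (zeroʳ c) (∙-zerosʳ x)) (+-identityˡ 0#)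

  ∙-linearʳ : ∀ {n} (x u v : Vec Carrier n) α β → x ∙ (α ·ᵥ u +ᵥ β ·ᵥ v) ≡ α * (x ∙ u) + β * (x ∙ v)
  ∙-linearʳ []      []      []      α β = sym (trans (cong₂ _+_ (zeroʳ α) (zeroʳ β)) (+-identityˡ 0#))
  ∙-linearʳ (c ∷ x) (a ∷ u) (b ∷ v) α β = trans (cong (c * (α * a + β * b) +_) (∙-linearʳ x u v α β))
    (solve 7 (λ c α a β b d e → c :* (α :* a :+ β :* b) :+ (α :* d :+ β :* e)
                             := α :* (c :* a :+ d) :+ β :* (c :* b :+ e))
           refl c α a β b (x ∙ u) (x ∙ v))

  on-hyperplane? : ∀ {n} (w : Vec Carrier n) a x → Dec (x ∙ w ≡ a)
  on-hyperplane? w a x = (x ∙ w) ≟ a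

  on-both? : ∀ {n} (w w′ : Vec Carrier n) a b x → Dec (x ∙ w ≡ a × x ∙ w′ ≡ b)
  on-both? w w′ a b x = on-hyperplane? w a x ×-dec on-hyperplane? w′ b x

  #hyperplane : ∀ {n} → Vec Carrier n → Carrier → ℕ
  #hyperplane {n} w a = count (on-hyperplane? w a) (vectors n)

  #hyperplane₂ : ∀ {n} → Vec Carrier n → Vec Carrier n → Carrier → Carrier → ℕ
  #hyperplane₂ {n} w w′ a b = count (on-both? w w′ a b) (vectors n)

  #hyperplane-suc : ∀ {n} w₀ (w : Vec Carrier n) a →
                    #hyperplane (w₀ ∷ w) a ≡ sumₗ elements (λ c → #hyperplane w (a + - (c * w₀)))
  #hyperplane-suc {n} w₀ w a =
    trans (sumₗ-vectors n _) (sumₗ-cong elements λ {c} _ → sumₗ-cong (vectors n) λ {x} _ →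
      𝟙-cong (on-hyperplane? (w₀ ∷ w) a (c ∷ x)) (on-hyperplane? w (a + - (c * w₀)) x)
             x+y≡z⇒y≡z-x y≡z-x⇒x+y≡z)

  #hyperplane₂-suc : ∀ {n} w₀ w₀′ (w w′ : Vec Carrier n) a b →
                     #hyperplane₂ (w₀ ∷ w) (w₀′ ∷ w′) a b ≡
                     sumₗ elements (λ c → #hyperplane₂ w w′ (a + - (c * w₀)) (b + - (c * w₀′)))
  #hyperplane₂-suc {n} w₀ w₀′ w w′ a b =
    trans (sumₗ-vectors n _) (sumₗ-cong elements λ {c} _ → sumₗ-cong (vectors n) λ {x} _ →
      𝟙-cong (on-both? (w₀ ∷ w) (w₀′ ∷ w′) a b (c ∷ x)) (on-both? w w′ (a + - (c * w₀)) (b + - (c * w₀′)) x)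
             (λ (e , e′) → x+y≡z⇒y≡z-x e , x+y≡z⇒y≡z-x e′) (λ (e , e′) → y≡z-x⇒x+y≡z e , y≡z-x⇒x+y≡z e′))

  #hyperplane₂≤#hyperplaneˡ : ∀ {n} (w w′ : Vec Carrier n) a b → #hyperplane₂ w w′ a b ℕ.≤ #hyperplane w a
  #hyperplane₂≤#hyperplaneˡ {n} w w′ a b =
    sumₗ-mono (vectors n) λ {x} _ → 𝟙-mono (on-both? w w′ a b x) (on-hyperplane? w a x) proj₁

  #hyperplane₂≤#hyperplaneʳ : ∀ {n} (w w′ : Vec Carrier n) a b → #hyperplane₂ w w′ a b ℕ.≤ #hyperplane w′ b
  #hyperplane₂≤#hyperplaneʳ {n} w w′ a b =
    sumₗ-mono (vectors n) λ {x} _ → 𝟙-mono (on-both? w w′ a b x) (on-hyperplane? w′ b x) proj₂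

  unique-multiplier : ∀ {w} a → w ≢ 0# → count (λ c → (c * w) ≟ a) elements ≡ 1
  unique-multiplier {w} a w≢0 with inverse w w≢0
  ... | w⁻¹ , w*w⁻¹≡1 = count≡1 (λ c → (c * w) ≟ a) elements-unique (∈-elements (a * w⁻¹))
    (trans (*-assoc a w⁻¹ w) (trans (cong (a *_) (trans (*-comm w⁻¹ w) w*w⁻¹≡1)) (*-identityʳ a)))
    (λ cw≡a c′w≡a → *-cancelʳ-nonzero w≢0 (trans cw≡a (sym c′w≡a)))

  q*#hyperplane≡q^n : ∀ {n} (w : Vec Carrier n) → w ≢ zeros n → ∀ a → q ℕ.* #hyperplane w a ≡ q ℕ.^ n
  q*#hyperplane≡q^n []       w≢0 a = contradiction refl w≢0
  q*#hyperplane≡q^n {suc n} (w₀ ∷ w) w≢0 a with w ≟ᵥ zeros n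
  ... | no w≢0′ = begin
    q ℕ.* #hyperplane (w₀ ∷ w) a
      ≡⟨ cong (q ℕ.*_) (#hyperplane-suc w₀ w a) ⟩
    q ℕ.* sumₗ elements (λ c → #hyperplane w (a + - (c * w₀)))
      ≡⟨ *-distribˡ-sumₗ q elements _ ⟩
    sumₗ elements (λ c → q ℕ.* #hyperplane w (a + - (c * w₀)))
      ≡⟨ sumₗ-cong elements (λ _ → q*#hyperplane≡q^n w w≢0′ _) ⟩
    sumₗ elements (λ _ → q ℕ.^ n)
      ≡⟨ sumₗ-elements-const _ ⟩
    q ℕ.^ suc n ∎
    where open ≡-Reasoning
  ... | yes refl = begin
    q ℕ.* #hyperplane (w₀ ∷ zeros n) a
      ≡⟨ cong (q ℕ.*_) (sumₗ-vectors n _) ⟩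
    q ℕ.* sumₗ elements (λ c → sumₗ (vectors n) (λ x → 𝟙 ((c * w₀ + x ∙ zeros n) ≟ a)))
      ≡⟨ cong (q ℕ.*_) (sumₗ-cong elements λ {c} _ → sumₗ-cong (vectors n) λ {x} _ →
           cong (λ t → 𝟙 ((c * w₀ + t) ≟ a)) (∙-zerosʳ x)) ⟩
    q ℕ.* sumₗ elements (λ c → sumₗ (vectors n) (λ _ → 𝟙 ((c * w₀ + 0#) ≟ a)))
      ≡⟨ cong (q ℕ.*_) (sumₗ-cong elements λ _ → sumₗ-vectors-const n _) ⟩
    q ℕ.* sumₗ elements (λ c → q ℕ.^ n ℕ.* 𝟙 ((c * w₀ + 0#) ≟ a))
      ≡⟨ cong (q ℕ.*_) (*-distribˡ-sumₗ (q ℕ.^ n) elements _) ⟨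
    q ℕ.* (q ℕ.^ n ℕ.* sumₗ elements (λ c → 𝟙 ((c * w₀ + 0#) ≟ a)))
      ≡⟨ cong (λ t → q ℕ.* (q ℕ.^ n ℕ.* t)) single-solution ⟩
    q ℕ.* (q ℕ.^ n ℕ.* 1)
      ≡⟨ cong (q ℕ.*_) (ℕₚ.*-identityʳ _) ⟩
    q ℕ.^ suc n ∎
    where
    open ≡-Reasoning
    w₀≢0 : w₀ ≢ 0#
    w₀≢0 refl = w≢0 refl
    single-solution : sumₗ elements (λ c → 𝟙 ((c * w₀ + 0#) ≟ a)) ≡ 1
    single-solution = trans (sumₗ-cong elements λ {c} _ → cong (λ t → 𝟙 (t ≟ a)) (+-identityʳ (c * w₀)))
                            (unique-multiplier a w₀≢0)

  Independent : ∀ {n} → Vec Carrier n → Vec Carrier n → Set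
  Independent {n} w w′ = ∀ α β → α ·ᵥ w +ᵥ β ·ᵥ w′ ≡ zeros n → α ≡ 0# × β ≡ 0#

  Dependent : ∀ {n} → Vec Carrier n → Vec Carrier n → Set
  Dependent {n} w w′ = Σ Carrier λ α → Σ Carrier λ β →
                       α ·ᵥ w +ᵥ β ·ᵥ w′ ≡ zeros n × ¬ (α ≡ 0# × β ≡ 0#)

  independent-or-dependent : ∀ {n} (w w′ : Vec Carrier n) → Independent w w′ ⊎ Dependent w w′
  independent-or-dependent {n} w w′ with any? (λ α → any? (relation? α) elements) elements
    where
    relation? : ∀ α β → Dec (α ·ᵥ w +ᵥ β ·ᵥ w′ ≡ zeros n × ¬ (α ≡ 0# × β ≡ 0#))
    relation? α β = (α ·ᵥ w +ᵥ β ·ᵥ w′) ≟ᵥ zeros n ×-dec ¬? ((α ≟ 0#) ×-dec (β ≟ 0#))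
  ... | yes some with satisfied some
  ...   | α , some-β with satisfied some-β
  ...     | β , relation = inj₂ (α , β , relation)
  independent-or-dependent {n} w w′ | no none = inj₁ λ α β combination≡0 →
    decidable-stable ((α ≟ 0#) ×-dec (β ≟ 0#)) λ nontrivial →
      none (lose (∈-elements α) (lose (∈-elements β) (combination≡0 , nontrivial)))

  combination-zeros : ∀ {n} α β → α ·ᵥ zeros n +ᵥ β ·ᵥ zeros n ≡ zeros n
  combination-zeros {zero}  α β = refl
  combination-zeros {suc n} α β =
    cong₂ _∷_ (trans (cong₂ _+_ (zeroʳ α) (zeroʳ β)) (+-identityˡ 0#)) (combination-zeros α β)

  ¬Independent-[] : ¬ Independent [] []
  ¬Independent-[] independent = 0≢1 (sym (proj₁ (independent 1# 0# refl)))

  Independent⇒tail≢zeros : ∀ {n w₀ w₀′} {w w′ : Vec Carrier n} → Independent (w₀ ∷ w) (w₀′ ∷ w′) →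
                           w ≡ zeros n → w′ ≡ zeros n → ⊥
  Independent⇒tail≢zeros {n} {w₀} {w₀′} independent refl refl =
    0≢1 (sym (proj₁ (independent 1# 0# (cong₂ _∷_ e₁ (combination-zeros 1# 0#)))))
    where
    cross-combination : w₀′ * w₀ + - w₀ * w₀′ ≡ 0#
    cross-combination = begin
      w₀′ * w₀ + - w₀ * w₀′    ≡⟨ cong (w₀′ * w₀ +_) (-‿distribˡ-* w₀ w₀′) ⟨
      w₀′ * w₀ + - (w₀ * w₀′)  ≡⟨ cong (λ t → t + - (w₀ * w₀′)) (*-comm w₀′ w₀) ⟩
      w₀ * w₀′ + - (w₀ * w₀′)  ≡⟨ -‿inverseʳ (w₀ * w₀′) ⟩
      0#                       ∎
      where open ≡-Reasoning
    w₀≡0 : w₀ ≡ 0#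
    w₀≡0 = -‿injective (trans (proj₂ (independent w₀′ (- w₀) (cong₂ _∷_ cross-combination (combination-zeros w₀′ (- w₀)))))
                              (sym -0#≈0#))
    e₁ : 1# * w₀ + 0# * w₀′ ≡ 0#
    e₁ = trans (cong₂ _+_ (trans (*-identityˡ w₀) w₀≡0) (zeroˡ w₀′)) (+-identityˡ 0#)

  non-proportional⇒Independent : ∀ {n} {w w′ : Vec Carrier n} →
                                 w ≢ zeros n → (∀ c → w′ ≢ c ·ᵥ w) → Independent w w′
  non-proportional⇒Independent {n} {w} {w′} w≢0 non-proportional α β combination≡0 with β ≟ 0#
  ... | no β≢0 = contradiction (solve-for-second (proj₂ (inverse β β≢0)) w w′ combination≡0) (non-proportional _)
    where
    β⁻¹ : Carrier
    β⁻¹ = proj₁ (inverse β β≢0)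
    solve-for-second : β * β⁻¹ ≡ 1# → ∀ {m} (u u′ : Vec Carrier m) →
                       α ·ᵥ u +ᵥ β ·ᵥ u′ ≡ zeros m → u′ ≡ (- (β⁻¹ * α)) ·ᵥ u
    solve-for-second ββ⁻¹≡1 []      []        _  = refl
    solve-for-second ββ⁻¹≡1 (x ∷ u) (x′ ∷ u′) eq =
      cong₂ _∷_ head-eq (solve-for-second ββ⁻¹≡1 u u′ (Vecₚ.∷-injectiveʳ eq))
      where
      open ≡-Reasoning
      head-eq : x′ ≡ - (β⁻¹ * α) * x
      head-eq = begin
        x′                 ≡⟨ *-identityˡ x′ ⟨
        1# * x′            ≡⟨ cong (_* x′) (trans (*-comm β⁻¹ β) ββ⁻¹≡1) ⟨
        β⁻¹ * β * x′       ≡⟨ *-assoc β⁻¹ β x′ ⟩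
        β⁻¹ * (β * x′)     ≡⟨ cong (β⁻¹ *_) (+-inverseʳ-unique (α * x) (β * x′) (Vecₚ.∷-injectiveˡ eq)) ⟩
        β⁻¹ * - (α * x)    ≡⟨ -‿distribʳ-* β⁻¹ (α * x) ⟨
        - (β⁻¹ * (α * x))  ≡⟨ cong -_ (*-assoc β⁻¹ α x) ⟨
        - (β⁻¹ * α * x)    ≡⟨ -‿distribˡ-* (β⁻¹ * α) x ⟩
        - (β⁻¹ * α) * x    ∎
  ... | yes refl with α ≟ 0#
  ...   | yes α≡0 = α≡0 , refl
  ...   | no  α≢0 = contradiction (scaled-vanishes w w′ combination≡0) w≢0
    where
    scaled-vanishes : ∀ {m} (u u′ : Vec Carrier m) → α ·ᵥ u +ᵥ 0# ·ᵥ u′ ≡ zeros m → u ≡ zeros m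
    scaled-vanishes []      []        _  = refl
    scaled-vanishes (x ∷ u) (x′ ∷ u′) eq = cong₂ _∷_
      (*-cancelˡ-nonzero α≢0 (trans (sym (trans (cong (α * x +_) (zeroˡ x′)) (+-identityʳ _)))
                                    (trans (Vecₚ.∷-injectiveˡ eq) (sym (zeroʳ α)))))
      (scaled-vanishes u u′ (Vecₚ.∷-injectiveʳ eq))

  dependency-fixes-multiplier : ∀ {n} {w w′ : Vec Carrier n} {α β} → α ·ᵥ w +ᵥ β ·ᵥ w′ ≡ zeros n →
    ∀ {x c w₀ w₀′ a b} → c * w₀ + x ∙ w ≡ a → c * w₀′ + x ∙ w′ ≡ b →
    c * (α * w₀ + β * w₀′) ≡ α * a + β * b
  dependency-fixes-multiplier {n} {w} {w′} {α} {β} relation {x} {c} {w₀} {w₀′} {a} {b} eq eq′ = sym (begin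
    α * a + β * b
      ≡⟨ cong₂ (λ s t → α * s + β * t) (sym eq) (sym eq′) ⟩
    α * (c * w₀ + x ∙ w) + β * (c * w₀′ + x ∙ w′)
      ≡⟨ solve 7 (λ α β c w₀ w₀′ d d′ → α :* (c :* w₀ :+ d) :+ β :* (c :* w₀′ :+ d′)
                                     := c :* (α :* w₀ :+ β :* w₀′) :+ (α :* d :+ β :* d′))
               refl α β c w₀ w₀′ (x ∙ w) (x ∙ w′) ⟩
    c * (α * w₀ + β * w₀′) + (α * (x ∙ w) + β * (x ∙ w′))
      ≡⟨ cong (c * (α * w₀ + β * w₀′) +_) (∙-linearʳ x w w′ α β) ⟨
    c * (α * w₀ + β * w₀′) + x ∙ (α ·ᵥ w +ᵥ β ·ᵥ w′)
      ≡⟨ cong (λ v → c * (α * w₀ + β * w₀′) + x ∙ v) relation ⟩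
    c * (α * w₀ + β * w₀′) + x ∙ zeros n
      ≡⟨ cong (c * (α * w₀ + β * w₀′) +_) (∙-zerosʳ x) ⟩
    c * (α * w₀ + β * w₀′) + 0#
      ≡⟨ +-identityʳ _ ⟩
    c * (α * w₀ + β * w₀′) ∎)
    where open ≡-Reasoning

  q*#hyperplane₂≤q^n : ∀ {n} (w w′ : Vec Carrier n) → ¬ (w ≡ zeros n × w′ ≡ zeros n) → ∀ a b →
                       q ℕ.* #hyperplane₂ w w′ a b ℕ.≤ q ℕ.^ n
  q*#hyperplane₂≤q^n {n} w w′ not-both-zero a b with w ≟ᵥ zeros n | w′ ≟ᵥ zeros n
  ... | no w≢0 | _ =
    ℕₚ.≤-trans (ℕₚ.*-monoʳ-≤ q (#hyperplane₂≤#hyperplaneˡ w w′ a b)) (ℕₚ.≤-reflexive (q*#hyperplane≡q^n w w≢0 a))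
  ... | yes _ | no w′≢0 =
    ℕₚ.≤-trans (ℕₚ.*-monoʳ-≤ q (#hyperplane₂≤#hyperplaneʳ w w′ a b)) (ℕₚ.≤-reflexive (q*#hyperplane≡q^n w′ w′≢0 b))
  ... | yes w≡0 | yes w′≡0 = contradiction (w≡0 , w′≡0) not-both-zero

  off-multiplier-slice-empty : ∀ {n} {w w′ : Vec Carrier n} {α β} → α ·ᵥ w +ᵥ β ·ᵥ w′ ≡ zeros n →
    ∀ {c w₀ w₀′ a b} → c * (α * w₀ + β * w₀′) ≢ α * a + β * b →
    #hyperplane₂ w w′ (a + - (c * w₀)) (b + - (c * w₀′)) ≡ 0
  off-multiplier-slice-empty {n} relation c*γ≢ = count-none _ (vectors n) λ {x} _ (eq , eq′) →
    c*γ≢ (dependency-fixes-multiplier relation {x} (y≡z-x⇒x+y≡z eq) (y≡z-x⇒x+y≡z eq′))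

  -- Induction on the first coordinate c of x.  If the tails of w, w′ are still independent, every slice is
  -- small; otherwise a dependency α·tail + β·tail′ = 0 forces c·γ = α a + β b with γ ≠ 0, so only one
  -- slice is nonempty and it lies in a single hyperplane of the tail.
  q*q*#hyperplane₂≤q^n : ∀ {n} {w w′ : Vec Carrier n} → Independent w w′ → ∀ a b →
                         q ℕ.* (q ℕ.* #hyperplane₂ w w′ a b) ℕ.≤ q ℕ.^ n
  q*q*#hyperplane₂≤q^n {zero}  {[]}     {[]}       independent a b = contradiction independent ¬Independent-[]
  q*q*#hyperplane₂≤q^n {suc n} {w₀ ∷ w} {w₀′ ∷ w′} independent a b
    rewrite #hyperplane₂-suc w₀ w₀′ w w′ a b
    with independent-or-dependent w w′
  ... | inj₁ independent′ = begin
    q ℕ.* (q ℕ.* sumₗ elements H)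
      ≡⟨ cong (q ℕ.*_) (*-distribˡ-sumₗ q elements H) ⟩
    q ℕ.* sumₗ elements (λ c → q ℕ.* H c)
      ≡⟨ *-distribˡ-sumₗ q elements _ ⟩
    sumₗ elements (λ c → q ℕ.* (q ℕ.* H c))
      ≤⟨ sumₗ-mono elements (λ _ → q*q*#hyperplane₂≤q^n independent′ _ _) ⟩
    sumₗ elements (λ _ → q ℕ.^ n)
      ≡⟨ sumₗ-elements-const _ ⟩
    q ℕ.^ suc n ∎
    where
    open ℕₚ.≤-Reasoning
    H : Carrier → ℕ
    H c = #hyperplane₂ w w′ (a + - (c * w₀)) (b + - (c * w₀′))
  ... | inj₂ (α , β , relation , nontrivial) = begin
    q ℕ.* (q ℕ.* sumₗ elements H)
      ≡⟨ cong (q ℕ.*_) (*-distribˡ-sumₗ q elements H) ⟩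
    q ℕ.* sumₗ elements (λ c → q ℕ.* H c)
      ≤⟨ ℕₚ.*-monoʳ-≤ q (sumₗ-mono elements λ {c} _ → q*H≤q^n*𝟙 c) ⟩
    q ℕ.* sumₗ elements (λ c → q ℕ.^ n ℕ.* 𝟙 (c*γ≟ c))
      ≡⟨ cong (q ℕ.*_) (*-distribˡ-sumₗ (q ℕ.^ n) elements _) ⟨
    q ℕ.* (q ℕ.^ n ℕ.* count c*γ≟ elements)
      ≤⟨ ℕₚ.*-monoʳ-≤ q (ℕₚ.*-monoʳ-≤ (q ℕ.^ n) at-most-one-multiplier) ⟩
    q ℕ.* (q ℕ.^ n ℕ.* 1)
      ≡⟨ cong (q ℕ.*_) (ℕₚ.*-identityʳ _) ⟩
    q ℕ.^ suc n ∎
    where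
    open ℕₚ.≤-Reasoning
    H : Carrier → ℕ
    H c = #hyperplane₂ w w′ (a + - (c * w₀)) (b + - (c * w₀′))
    γ : Carrier
    γ = α * w₀ + β * w₀′
    γ≢0 : γ ≢ 0#
    γ≢0 γ≡0 = nontrivial (independent α β (cong₂ _∷_ γ≡0 relation))
    c*γ≟ : ∀ c → Dec (c * γ ≡ α * a + β * b)
    c*γ≟ c = (c * γ) ≟ (α * a + β * b)
    at-most-one-multiplier : count c*γ≟ elements ℕ.≤ 1
    at-most-one-multiplier = count≤1 c*γ≟ elements-unique λ eq eq′ → *-cancelʳ-nonzero γ≢0 (trans eq (sym eq′))
    q*H≤q^n*𝟙 : ∀ c → q ℕ.* H c ℕ.≤ q ℕ.^ n ℕ.* 𝟙 (c*γ≟ c)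
    q*H≤q^n*𝟙 c with c*γ≟ c
    ... | yes _ = ℕₚ.≤-trans (q*#hyperplane₂≤q^n w w′ tail≢zeros _ _) (ℕₚ.≤-reflexive (sym (ℕₚ.*-identityʳ _)))
      where
      tail≢zeros : ¬ (w ≡ zeros n × w′ ≡ zeros n)
      tail≢zeros (w≡0 , w′≡0) = Independent⇒tail≢zeros independent w≡0 w′≡0
    ... | no c*γ≢ = ℕₚ.≤-reflexive (begin-equality
      q ℕ.* H c                 ≡⟨ cong (q ℕ.*_) (off-multiplier-slice-empty relation c*γ≢) ⟩
      q ℕ.* 0                   ≡⟨ ℕₚ.*-zeroʳ q ⟩
      0                         ≡⟨ ℕₚ.*-zeroʳ (q ℕ.^ n) ⟨
      q ℕ.^ n ℕ.* 0             ∎)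

module Forms {q : ℕ} (F : FiniteField q) where

  open FieldProperties F
  open Vectors F
  open Determinant F using (Matrix; nonzero-kernel⇒det≡0)

  infixr 8 _·ᴹ_

  _·ᴹ_ : ∀ {n} → Matrix n → Vec Carrier n → Vec Carrier n
  _·ᴹ_ {n} A y = tabulate (λ i → ∑ n (λ j → A i j * lookup y j))

  lookup-·ᴹ : ∀ {n} (A : Matrix n) y i → lookup (A ·ᴹ y) i ≡ ∑ n (λ j → A i j * lookup y j)
  lookup-·ᴹ A y = Vecₚ.lookup∘tabulate _

  bilin≡∙·ᴹ : ∀ n (A : Matrix n) x y → bilin n A x y ≡ x ∙ (A ·ᴹ y)
  bilin≡∙·ᴹ n A x y = ∑-cong n λ i → begin
    ∑ n (λ j → lookup x i * A i j * lookup y j)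
      ≡⟨ ∑-cong n (λ j → *-assoc (lookup x i) (A i j) (lookup y j)) ⟩
    ∑ n (λ j → lookup x i * (A i j * lookup y j))
      ≡⟨ *-distribˡ-∑ n (lookup x i) _ ⟨
    lookup x i * ∑ n (λ j → A i j * lookup y j)
      ≡⟨ cong (lookup x i *_) (lookup-·ᴹ A y i) ⟨
    lookup x i * lookup (A ·ᴹ y) i ∎
    where open ≡-Reasoning

  bilin-sym : ∀ n (A : Matrix n) → Symmetric n A → ∀ x y → bilin n A x y ≡ bilin n A y x
  bilin-sym n A A-sym x y = trans (∑-comm n n _) (∑-cong n λ j → ∑-cong n λ i →
    trans (cong (λ a → lookup x i * a * lookup y j) (A-sym i j))
          (solve 3 (λ x a y → x :* a :* y := y :* a :* x) refl (lookup x i) (A j i) (lookup y j)))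

  lookup-ext : ∀ {n} {y z : Vec Carrier n} → (∀ i → lookup y i ≡ lookup z i) → y ≡ z
  lookup-ext {y = y} {z} y≗z =
    trans (sym (Vecₚ.tabulate∘lookup y)) (trans (Vecₚ.tabulate-cong y≗z) (Vecₚ.tabulate∘lookup z))

  ·ᴹ-zeros : ∀ {n} (A : Matrix n) → A ·ᴹ zeros n ≡ zeros n
  ·ᴹ-zeros {n} A = lookup-ext λ i → begin
    lookup (A ·ᴹ zeros n) i
      ≡⟨ lookup-·ᴹ A (zeros n) i ⟩
    ∑ n (λ j → A i j * lookup (zeros n) j)
      ≡⟨ ∑-zero n (λ j → trans (cong (A i j *_) (Vecₚ.lookup-replicate j 0#)) (zeroʳ _)) ⟩
    0#
      ≡⟨ Vecₚ.lookup-replicate i 0# ⟨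
    lookup (zeros n) i ∎
    where open ≡-Reasoning

  module _ {n} {A : Matrix n} (A-nondegenerate : NonDegenerate n A) where

    ·ᴹ-injective : ∀ {y z} → A ·ᴹ y ≡ A ·ᴹ z → y ≡ z
    ·ᴹ-injective {y} {z} Ay≡Az = lookup-ext λ c → with-difference c ((lookup y c + - lookup z c) ≟ 0#)
      where
      d : Fin n → Carrier
      d k = lookup y k + - lookup z k
      Ad≡0 : ∀ r → ∑ n (λ k → A r k * d k) ≡ 0#
      Ad≡0 r = begin
        ∑ n (λ k → A r k * d k)
          ≡⟨ ∑-cong n (λ k → x[y-z]≈xy-xz (A r k) (lookup y k) (lookup z k)) ⟩
        ∑ n (λ k → A r k * lookup y k + - (A r k * lookup z k))
          ≡⟨ ∑-distrib-+ n _ _ ⟩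
        ∑ n (λ k → A r k * lookup y k) + ∑ n (λ k → - (A r k * lookup z k))
          ≡⟨ cong (∑ n (λ k → A r k * lookup y k) +_) (-‿distrib-∑ n _) ⟨
        ∑ n (λ k → A r k * lookup y k) + - ∑ n (λ k → A r k * lookup z k)
          ≡⟨ cong₂ (λ s t → s + - t) (lookup-·ᴹ A y r) (lookup-·ᴹ A z r) ⟨
        lookup (A ·ᴹ y) r + - lookup (A ·ᴹ z) r
          ≡⟨ cong (λ v → lookup v r + - lookup (A ·ᴹ z) r) Ay≡Az ⟩
        lookup (A ·ᴹ z) r + - lookup (A ·ᴹ z) r
          ≡⟨ -‿inverseʳ _ ⟩
        0# ∎
        where open ≡-Reasoning
      with-difference : ∀ c → Dec (d c ≡ 0#) → lookup y c ≡ lookup z c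
      with-difference c (yes dc≡0) = x∙y⁻¹≈ε⇒x≈y _ _ dc≡0
      with-difference c (no  dc≢0) = contradiction (nonzero-kernel⇒det≡0 n A d Ad≡0 c dc≢0) A-nondegenerate

    ·ᴹ-nonzero : ∀ {y} → y ≢ zeros n → A ·ᴹ y ≢ zeros n
    ·ᴹ-nonzero y≢0 Ay≡0 = y≢0 (·ᴹ-injective (trans Ay≡0 (sym (·ᴹ-zeros A))))

module OrthogonalSets {q : ℕ} (F : FiniteField q) {n : ℕ} (A : Fin n → Fin n → FiniteField.Carrier F)
  (A-symmetric : FieldOps.Symmetric F n A) (A-nondegenerate : FieldOps.NonDegenerate F n A)
  (S : List (Vec (FiniteField.Carrier F) n)) (S-unique : Unique S)
  (S-nonzero : All (λ x → x ≢ replicate n (FiniteField.0# F)) S) where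

  open FieldProperties F using (Carrier; 0#; _≟_; bilin)
  open Vectors F
  open Forms F
  open ℕΣ

  w : Vec Carrier n → Vec Carrier n
  w y = A ·ᴹ y

  w-nonzero : ∀ {y} → y ∈ S → w y ≢ zeros n
  w-nonzero y∈S = ·ᴹ-nonzero A-nondegenerate (All.lookup S-nonzero y∈S)

  Orthogonal : Rel (Vec Carrier n) 0ℓ
  Orthogonal x y = bilin n A x y ≡ 0#

  orthogonal? : Decidable Orthogonal
  orthogonal? x y = bilin n A x y ≟ 0#

  orthogonal-w? : ∀ x y → Dec (x ∙ w y ≡ 0#)
  orthogonal-w? x y = on-hyperplane? (w y) 0# x

  #orthogonal : Vec Carrier n → ℕ
  #orthogonal x = count (orthogonal-w? x) S

  s N : ℕ
  s = length S
  N = sumₗ S #orthogonal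

  open CaroWei _≟ᵥ_ orthogonal? (λ {x} {y} → trans (bilin-sym n A A-symmetric y x))

  degree≤1+#orthogonal : ∀ x → degree S x ℕ.≤ 1 ℕ.+ #orthogonal x
  degree≤1+#orthogonal x = begin
    sumₗ S (λ y → 𝟙 (closed? x y))
      ≤⟨ sumₗ-mono S (λ {y} _ → 𝟙-⊎ (x ≟ᵥ y) (orthogonal? x y)) ⟩
    sumₗ S (λ y → 𝟙 (x ≟ᵥ y) ℕ.+ 𝟙 (orthogonal? x y))
      ≡⟨ sumₗ-distrib-+ S _ _ ⟩
    count (x ≟ᵥ_) S ℕ.+ count (orthogonal? x) S
      ≤⟨ ℕₚ.+-mono-≤ (count≤1 _ S-unique λ x≡y x≡y′ → trans (sym x≡y) x≡y′) (ℕₚ.≤-reflexive same-count) ⟩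
    1 ℕ.+ #orthogonal x ∎
    where
    open ℕₚ.≤-Reasoning
    same-count : count (orthogonal? x) S ≡ #orthogonal x
    same-count = sumₗ-cong S λ {y} _ → 𝟙-cong (orthogonal? x y) (orthogonal-w? x y)
                                              (trans (sym (bilin≡∙·ᴹ n A x y))) (trans (bilin≡∙·ᴹ n A x y))

  s*s≤r*[s+N] : ∀ r → NoIndependentSet (suc r) S → s ℕ.* s ℕ.≤ r ℕ.* (s ℕ.+ N)
  s*s≤r*[s+N] r noI = ℕₚ.≤-trans (caroWei r S noI) (ℕₚ.*-monoʳ-≤ r (begin
    sumₗ S (degree S)                         ≤⟨ sumₗ-mono S (λ {x} _ → degree≤1+#orthogonal x) ⟩
    sumₗ S (λ x → 1 ℕ.+ #orthogonal x)        ≡⟨ sumₗ-distrib-+ S (λ _ → 1) #orthogonal ⟩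
    sumₗ S (λ _ → 1) ℕ.+ N                    ≡⟨ cong (ℕ._+ N) (trans (sumₗ-const S 1) (ℕₚ.*-identityʳ s)) ⟩
    s ℕ.+ N                                   ∎))
    where open ℕₚ.≤-Reasoning

  module SecondMoment where

    open import Data.Integer using (+_; +≤+; _+_; _*_; _-_; _≤_)
    open import Data.Integer.Tactic.RingSolver using (solve-∀)

    h : Vec Carrier n → Vec Carrier n → ℤ
    h y x = + q * + 𝟙 (orthogonal-w? x y) - + 1

    G : Vec Carrier n → ℤ
    G x = ℤΣ.sumₗ S (λ y → h y x)

    G≡ : ∀ x → G x ≡ + q * + #orthogonal x - + s
    G≡ x = begin
      G x
        ≡⟨ ℤΣ.sumₗ-affine S (+ q) (λ y → + 𝟙 (orthogonal-w? x y)) (+ 1) ⟩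
      + q * ℤΣ.sumₗ S (λ y → + 𝟙 (orthogonal-w? x y)) - + s * + 1
        ≡⟨ cong₂ (λ c t → + q * c - t) (sym (ℤΣ.+-sumₗ S _)) (ℤₚ.*-identityʳ (+ s)) ⟩
      + q * + #orthogonal x - + s ∎
      where open ≡-Reasoning

    ∑G≡ : ℤΣ.sumₗ S G ≡ + q * + N - + s * + s
    ∑G≡ = begin
      ℤΣ.sumₗ S G
        ≡⟨ ℤΣ.sumₗ-cong S (λ {x} _ → G≡ x) ⟩
      ℤΣ.sumₗ S (λ x → + q * + #orthogonal x - + s)
        ≡⟨ ℤΣ.sumₗ-affine S (+ q) (λ x → + #orthogonal x) (+ s) ⟩
      + q * ℤΣ.sumₗ S (λ x → + #orthogonal x) - + s * + s
        ≡⟨ cong (λ c → + q * c - + s * + s) (ℤΣ.+-sumₗ S #orthogonal) ⟨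
      + q * + N - + s * + s ∎
      where open ≡-Reasoning

    correlation : Vec Carrier n → Vec Carrier n → ℤ
    correlation y z = ℤΣ.sumₗ (vectors n) (λ x → h y x * h z x)

    ∑G²≡∑correlation : ℤΣ.sumₗ (vectors n) (λ x → G x * G x) ≡
                       ℤΣ.sumₗ S (λ y → ℤΣ.sumₗ S (correlation y))
    ∑G²≡∑correlation = begin
      ℤΣ.sumₗ (vectors n) (λ x → G x * G x)
        ≡⟨ ℤΣ.sumₗ-cong (vectors n) (λ {x} _ → square-of-sum x) ⟩
      ℤΣ.sumₗ (vectors n) (λ x → ℤΣ.sumₗ S (λ y → ℤΣ.sumₗ S (λ z → h y x * h z x)))
        ≡⟨ ℤΣ.sumₗ-comm (vectors n) S _ ⟩
      ℤΣ.sumₗ S (λ y → ℤΣ.sumₗ (vectors n) (λ x → ℤΣ.sumₗ S (λ z → h y x * h z x)))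
        ≡⟨ ℤΣ.sumₗ-cong S (λ {y} _ → ℤΣ.sumₗ-comm (vectors n) S _) ⟩
      ℤΣ.sumₗ S (λ y → ℤΣ.sumₗ S (correlation y)) ∎
      where
      open ≡-Reasoning
      square-of-sum : ∀ x → G x * G x ≡ ℤΣ.sumₗ S (λ y → ℤΣ.sumₗ S (λ z → h y x * h z x))
      square-of-sum x = begin
        G x * G x
          ≡⟨ ℤΣ.*-distribˡ-sumₗ (G x) S (λ z → h z x) ⟩
        ℤΣ.sumₗ S (λ z → G x * h z x)
          ≡⟨ ℤΣ.sumₗ-cong S (λ {z} _ → distribute z) ⟩
        ℤΣ.sumₗ S (λ z → ℤΣ.sumₗ S (λ y → h y x * h z x))
          ≡⟨ ℤΣ.sumₗ-comm S S (λ z y → h y x * h z x) ⟩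
        ℤΣ.sumₗ S (λ y → ℤΣ.sumₗ S (λ z → h y x * h z x)) ∎
        where
        distribute : ∀ z → G x * h z x ≡ ℤΣ.sumₗ S (λ y → h y x * h z x)
        distribute z = trans (ℤₚ.*-comm (G x) (h z x)) (trans (ℤΣ.*-distribˡ-sumₗ (h z x) S (λ y → h y x))
                                                              (ℤΣ.sumₗ-cong S λ {y} _ → ℤₚ.*-comm (h z x) (h y x)))

    #orthogonal-to-both : Vec Carrier n → Vec Carrier n → ℕ
    #orthogonal-to-both y z = #hyperplane₂ (w y) (w z) 0# 0#

    correlation≡ : ∀ {y z} → y ∈ S → z ∈ S →
                   correlation y z ≡ + (q ℕ.* (q ℕ.* #orthogonal-to-both y z)) - + q ℕ.^ n
    correlation≡ {y} {z} y∈S z∈S = begin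
      correlation y z
        ≡⟨ ℤΣ.sumₗ-affine-product (vectors n) (+ q) (λ x → + a x) (λ x → + b x) ⟩
      + q * + q * Σab - + q * Σa - + q * Σb + + length (vectors n)
        ≡⟨ cong₂ (λ u v → + q * + q * Σab - u - v + + length (vectors n)) (q*Σ≡q^n y∈S) (q*Σ≡q^n z∈S) ⟩
      + q * + q * Σab - + q ℕ.^ n - + q ℕ.^ n + + length (vectors n)
        ≡⟨ cong₂ (λ t l → + q * + q * t - + q ℕ.^ n - + q ℕ.^ n + + l) Σab≡C (length-vectors n) ⟩
      + q * + q * + C - + q ℕ.^ n - + q ℕ.^ n + + q ℕ.^ n
        ≡⟨ cancel (+ q) (+ C) (+ q ℕ.^ n) ⟩
      + q * (+ q * + C) - + q ℕ.^ n
        ≡⟨ cong (_- + q ℕ.^ n) (trans (ℤₚ.pos-* q (q ℕ.* C)) (cong (+ q *_) (ℤₚ.pos-* q C))) ⟨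
      + (q ℕ.* (q ℕ.* C)) - + q ℕ.^ n ∎
      where
      open ≡-Reasoning
      C : ℕ
      C = #orthogonal-to-both y z
      a b : Vec Carrier n → ℕ
      a x = 𝟙 (orthogonal-w? x y)
      b x = 𝟙 (orthogonal-w? x z)
      Σa Σb Σab : ℤ
      Σa  = ℤΣ.sumₗ (vectors n) (λ x → + a x)
      Σb  = ℤΣ.sumₗ (vectors n) (λ x → + b x)
      Σab = ℤΣ.sumₗ (vectors n) (λ x → + a x * + b x)
      q*Σ≡q^n : ∀ {v} → v ∈ S → + q * ℤΣ.sumₗ (vectors n) (λ x → + 𝟙 (orthogonal-w? x v)) ≡ + q ℕ.^ n
      q*Σ≡q^n {v} v∈S = begin
        + q * ℤΣ.sumₗ (vectors n) (λ x → + 𝟙 (orthogonal-w? x v))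
          ≡⟨ cong (+ q *_) (ℤΣ.+-sumₗ (vectors n) _) ⟨
        + q * + #hyperplane (w v) 0#
          ≡⟨ ℤₚ.pos-* q _ ⟨
        + (q ℕ.* #hyperplane (w v) 0#)
          ≡⟨ cong +_ (q*#hyperplane≡q^n (w v) (w-nonzero v∈S) 0#) ⟩
        + q ℕ.^ n ∎
      Σab≡C : Σab ≡ + C
      Σab≡C = trans (ℤΣ.sumₗ-cong (vectors n) λ {x} _ →
                       trans (sym (ℤₚ.pos-* (a x) (b x))) (cong +_ (𝟙-× (orthogonal-w? x y) (orthogonal-w? x z))))
                    (sym (ℤΣ.+-sumₗ (vectors n) _))
      cancel : ∀ Q C P → Q * Q * C - P - P + P ≡ Q * (Q * C) - P
      cancel = solve-∀

    #multipliers : Vec Carrier n → Vec Carrier n → ℕ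
    #multipliers y z = count (λ c → w z ≟ᵥ c ·ᵥ w y) elements

    correlation≤ : ∀ {y z} → y ∈ S → z ∈ S → correlation y z ≤ + (q ℕ.* q ℕ.^ n ℕ.* #multipliers y z)
    correlation≤ {y} {z} y∈S z∈S with #multipliers y z ℕ.≟ 0
    ... | yes none = begin
      correlation y z
        ≡⟨ correlation≡ y∈S z∈S ⟩
      + (q ℕ.* (q ℕ.* #orthogonal-to-both y z)) - + q ℕ.^ n
        ≤⟨ ℤₚ.i≤j⇒i-j≤0 (+≤+ (q*q*#hyperplane₂≤q^n independent 0# 0#)) ⟩
      + 0
        ≤⟨ +≤+ z≤n ⟩
      + (q ℕ.* q ℕ.^ n ℕ.* #multipliers y z) ∎
      where
      open ℤₚ.≤-Reasoning
      independent : Independent (w y) (w z)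
      independent = non-proportional⇒Independent (w-nonzero y∈S) λ c → count≡0⇒¬ _ none (∈-elements c)
    ... | no some = begin
      correlation y z
        ≡⟨ correlation≡ y∈S z∈S ⟩
      + (q ℕ.* (q ℕ.* #orthogonal-to-both y z)) - + q ℕ.^ n
        ≤⟨ ℤₚ.i≤j⇒i-k≤j (+ q ℕ.^ n) (+≤+ (ℕₚ.*-monoʳ-≤ q q*C≤q^n)) ⟩
      + (q ℕ.* q ℕ.^ n)
        ≤⟨ +≤+ (ℕₚ.m≤m*n (q ℕ.* q ℕ.^ n) (#multipliers y z) {{ℕ.≢-nonZero some}}) ⟩
      + (q ℕ.* q ℕ.^ n ℕ.* #multipliers y z) ∎
      where
      open ℤₚ.≤-Reasoning
      q*C≤q^n : q ℕ.* #orthogonal-to-both y z ℕ.≤ q ℕ.^ n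
      q*C≤q^n = ℕₚ.≤-trans (ℕₚ.*-monoʳ-≤ q (#hyperplane₂≤#hyperplaneˡ (w y) (w z) 0# 0#))
                           (ℕₚ.≤-reflexive (q*#hyperplane≡q^n (w y) (w-nonzero y∈S) 0#))

    ∑#multipliers≤q : ∀ y → sumₗ S (#multipliers y) ℕ.≤ q
    ∑#multipliers≤q y = begin
      sumₗ S (#multipliers y)
        ≡⟨ sumₗ-comm S elements _ ⟩
      sumₗ elements (λ c → count (λ z → w z ≟ᵥ c ·ᵥ w y) S)
        ≤⟨ sumₗ-mono elements (λ {c} _ → at-most-one c) ⟩
      sumₗ elements (λ _ → 1)
        ≡⟨ sumₗ-elements-const 1 ⟩
      q ℕ.* 1
        ≡⟨ ℕₚ.*-identityʳ q ⟩
      q ∎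
      where
      open ℕₚ.≤-Reasoning
      at-most-one : ∀ c → count (λ z → w z ≟ᵥ c ·ᵥ w y) S ℕ.≤ 1
      at-most-one c = count≤1 _ S-unique λ eq eq′ → ·ᴹ-injective A-nondegenerate (trans eq (sym eq′))

    row-bound : ∀ {y} → y ∈ S → ℤΣ.sumₗ S (correlation y) ≤ + (q ℕ.* q ℕ.^ n ℕ.* q)
    row-bound {y} y∈S = begin
      ℤΣ.sumₗ S (correlation y)
        ≤⟨ ℤΣ.sumₗ-mono S (correlation≤ y∈S) ⟩
      ℤΣ.sumₗ S (λ z → + (K ℕ.* #multipliers y z))
        ≡⟨ ℤΣ.+-sumₗ S _ ⟨
      + sumₗ S (λ z → K ℕ.* #multipliers y z)
        ≡⟨ cong +_ (*-distribˡ-sumₗ K S (#multipliers y)) ⟨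
      + (K ℕ.* sumₗ S (#multipliers y))
        ≤⟨ +≤+ (ℕₚ.*-monoʳ-≤ K (∑#multipliers≤q y)) ⟩
      + (K ℕ.* q) ∎
      where
      open ℤₚ.≤-Reasoning
      K : ℕ
      K = q ℕ.* q ℕ.^ n

    second-moment-bound : (+ q * + N - + s * + s) * (+ q * + N - + s * + s) ≤ (+ s * + s) * (+ q * + q * + q ℕ.^ n)
    second-moment-bound = begin
      (+ q * + N - + s * + s) * (+ q * + N - + s * + s)
        ≡⟨ cong₂ _*_ ∑G≡ ∑G≡ ⟨
      ℤΣ.sumₗ S G * ℤΣ.sumₗ S G
        ≤⟨ ℤΣ.cauchy-schwarz S G ⟩
      + s * ℤΣ.sumₗ S (λ x → G x * G x)
        ≤⟨ ℤₚ.*-monoˡ-≤-nonNeg (+ s) (ℤΣ.sumₗ-⊆ (λ x → ℤΣ.i*i≥0 (G x)) S-unique (λ {x} _ → ∈-vectors x)) ⟩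
      + s * ℤΣ.sumₗ (vectors n) (λ x → G x * G x)
        ≡⟨ cong (+ s *_) ∑G²≡∑correlation ⟩
      + s * ℤΣ.sumₗ S (λ y → ℤΣ.sumₗ S (correlation y))
        ≤⟨ ℤₚ.*-monoˡ-≤-nonNeg (+ s) (ℤΣ.sumₗ-mono S row-bound) ⟩
      + s * ℤΣ.sumₗ S (λ _ → + (q ℕ.* q ℕ.^ n ℕ.* q))
        ≡⟨ cong (+ s *_) (ℤΣ.sumₗ-const S _) ⟩
      + s * (+ s * + (q ℕ.* q ℕ.^ n ℕ.* q))
        ≡⟨ cong (λ t → + s * (+ s * t)) (trans (ℤₚ.pos-* (q ℕ.* q ℕ.^ n) q) (cong (_* + q) (ℤₚ.pos-* q _))) ⟩
      + s * (+ s * (+ q * + q ℕ.^ n * + q))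
        ≡⟨ regroup (+ s) (+ q) (+ q ℕ.^ n) ⟩
      (+ s * + s) * (+ q * + q * + q ℕ.^ n) ∎
      where
      open ℤₚ.≤-Reasoning
      regroup : ∀ s q p → s * (s * (q * p * q)) ≡ (s * s) * (q * q * p)
      regroup = solve-∀

module _ where
  open import Data.Integer using (+_; _+_; _*_; _-_; _≤_)
  open import Data.Integer.Tactic.RingSolver using (solve-∀)

  0≤i*j : ∀ {i j} → + 0 ≤ i → + 0 ≤ j → + 0 ≤ i * j
  0≤i*j {i} {j} 0≤i 0≤j =
    subst (_≤ i * j) (ℤₚ.*-zeroʳ i) (ℤₚ.*-monoˡ-≤-nonNeg i {{ℤ.nonNegative 0≤i}} 0≤j)

  i*i≤j*j : ∀ {i j} → + 0 ≤ i → i ≤ j → i * i ≤ j * j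
  i*i≤j*j {i} {j} 0≤i i≤j = ℤₚ.≤-trans (ℤₚ.*-monoˡ-≤-nonNeg i {{ℤ.nonNegative 0≤i}} i≤j)
                                       (ℤₚ.*-monoʳ-≤-nonNeg j {{ℤ.nonNegative (ℤₚ.≤-trans 0≤i i≤j)}} i≤j)

  bound-from-moments : ∀ {s r q d N P} .{{_ : ℤ.Positive s}} →
    d + r ≡ q → + 0 ≤ r → + 0 ≤ q → + 0 ≤ s * d - r * q →
    s * s ≤ r * (s + N) → (q * N - s * s) * (q * N - s * s) ≤ (s * s) * (q * q * P) →
    (s * d - r * q) * (s * d - r * q) ≤ (r * q) * (r * q) * P
  bound-from-moments {s} {r} {q} {d} {N} {P} d+r≡q 0≤r 0≤q 0≤X s*s≤r*[s+N] Y²≤s²q²P =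
    ℤₚ.*-cancelˡ-≤-pos _ _ s (ℤₚ.*-cancelˡ-≤-pos _ _ s (begin
      s * (s * (X * X))
        ≡⟨ regroupˡ s X ⟩
      (s * X) * (s * X)
        ≤⟨ i*i≤j*j (0≤i*j (ℤₚ.<⇒≤ (ℤₚ.positive⁻¹ s)) 0≤X) s*X≤r*Y ⟩
      (r * Y) * (r * Y)
        ≡⟨ regroupᵐ r Y ⟩
      (r * r) * (Y * Y)
        ≤⟨ ℤₚ.*-monoˡ-≤-nonNeg (r * r) {{ℤ.nonNegative (0≤i*j 0≤r 0≤r)}} Y²≤s²q²P ⟩
      (r * r) * ((s * s) * (q * q * P))
        ≡⟨ regroupʳ r s q P ⟩
      s * (s * ((r * q) * (r * q) * P)) ∎))
    where
    open ℤₚ.≤-Reasoning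
    X Y : ℤ
    X = s * d - r * q
    Y = q * N - s * s
    s*X≤r*Y : s * X ≤ r * Y
    s*X≤r*Y = ℤₚ.0≤i-j⇒j≤i (subst (+ 0 ≤_) (sym difference) (0≤i*j 0≤q (ℤₚ.i≤j⇒0≤j-i s*s≤r*[s+N])))
      where
      difference : r * Y - s * X ≡ q * (r * (s + N) - s * s)
      difference = subst (λ q → r * (q * N - s * s) - s * (s * d - r * q) ≡ q * (r * (s + N) - s * s))
                         d+r≡q (expand s r d N)
        where
        expand : ∀ s r d N → r * ((d + r) * N - s * s) - s * (s * d - r * (d + r)) ≡ (d + r) * (r * (s + N) - s * s)
        expand = solve-∀
    regroupˡ : ∀ s X → s * (s * (X * X)) ≡ (s * X) * (s * X)
    regroupˡ = solve-∀
    regroupᵐ : ∀ r Y → (r * Y) * (r * Y) ≡ (r * r) * (Y * Y)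
    regroupᵐ = solve-∀
    regroupʳ : ∀ r s q P → (r * r) * ((s * s) * (q * q * P)) ≡ s * (s * ((r * q) * (r * q) * P))
    regroupʳ = solve-∀

open import Data.Nat using (_+_; _*_; _∸_; _^_; _≤_; _<_)

module _ where
  open import Data.Integer using (+_; +≤+)

  +[m∸n]≡+m-+n : ∀ {m n} → n ≤ m → + (m ∸ n) ≡ + m ℤ.- + n
  +[m∸n]≡+m-+n {m} {n} n≤m = trans (sym (ℤₚ.⊖-≥ n≤m)) (sym (ℤₚ.m-n≡m⊖n m n))

  +[m^2]≡+m*+m : ∀ m → + (m ^ 2) ≡ + m ℤ.* + m
  +[m^2]≡+m*+m m = trans (cong (λ t → + (m * t)) (ℕₚ.*-identityʳ m)) (ℤₚ.pos-* m m)

  truncated-bound-from-moments : ∀ r q s N P → r < q → s * s ≤ r * (s + N) →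
    (+ q ℤ.* + N ℤ.- + s ℤ.* + s) ℤ.* (+ q ℤ.* + N ℤ.- + s ℤ.* + s) ℤ.≤ (+ s ℤ.* + s) ℤ.* (+ q ℤ.* + q ℤ.* + P) →
    ((s * (q ∸ suc r + 1)) ∸ (r * q)) ^ 2 ≤ (r * q) ^ 2 * P
  truncated-bound-from-moments r q s N P r<q s*s≤r*[s+N] second-moment with s * (q ∸ suc r + 1) ℕₚ.≤? r * q
  ... | yes small rewrite ℕₚ.m≤n⇒m∸n≡0 small = z≤n
  truncated-bound-from-moments r q zero    N P r<q _ _ | no large = contradiction z≤n large
  truncated-bound-from-moments r q (suc s) N P r<q s*s≤r*[s+N] second-moment | no large =
    ℤₚ.drop‿+≤+ (subst₂ ℤ._≤_ (sym lhs) (sym rhs)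
      (bound-from-moments {+ suc s} {+ r} {+ q} {+ d} {+ N} {+ P}
                          d+r≡q (+≤+ z≤n) (+≤+ z≤n) 0≤X s*s≤r*[s+N]ℤ second-moment))
    where
    d : ℕ
    d = q ∸ suc r + 1
    rq≤sd : r * q ≤ suc s * d
    rq≤sd = ℕₚ.<⇒≤ (ℕₚ.≰⇒> large)
    d+r≡q : + d ℤ.+ + r ≡ + q
    d+r≡q = trans (sym (ℤₚ.pos-+ d r)) (cong +_ (trans (ℕₚ.+-assoc (q ∸ suc r) 1 r) (ℕₚ.m∸n+n≡m r<q)))
    X≡ : + (suc s * d) ℤ.- + (r * q) ≡ + suc s ℤ.* + d ℤ.- + r ℤ.* + q
    X≡ = cong₂ ℤ._-_ (ℤₚ.pos-* (suc s) d) (ℤₚ.pos-* r q)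
    0≤X : + 0 ℤ.≤ + suc s ℤ.* + d ℤ.- + r ℤ.* + q
    0≤X = subst (+ 0 ℤ.≤_) X≡ (ℤₚ.i≤j⇒0≤j-i (+≤+ rq≤sd))
    s*s≤r*[s+N]ℤ : + suc s ℤ.* + suc s ℤ.≤ + r ℤ.* (+ suc s ℤ.+ + N)
    s*s≤r*[s+N]ℤ = subst₂ ℤ._≤_ (ℤₚ.pos-* (suc s) (suc s)) (ℤₚ.pos-* r (suc s + N)) (+≤+ s*s≤r*[s+N])
    lhs : + ((suc s * d ∸ r * q) ^ 2) ≡ (+ suc s ℤ.* + d ℤ.- + r ℤ.* + q) ℤ.* (+ suc s ℤ.* + d ℤ.- + r ℤ.* + q)
    lhs = trans (+[m^2]≡+m*+m (suc s * d ∸ r * q)) (cong (λ t → t ℤ.* t) (trans (+[m∸n]≡+m-+n rq≤sd) X≡))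
    rhs : + ((r * q) ^ 2 * P) ≡ (+ r ℤ.* + q) ℤ.* (+ r ℤ.* + q) ℤ.* + P
    rhs = trans (ℤₚ.pos-* ((r * q) ^ 2) P)
                (cong (ℤ._* + P) (trans (+[m^2]≡+m*+m (r * q)) (cong (λ t → t ℤ.* t) (ℤₚ.pos-* r q))))

theorem2p3 : (q n k : ℕ) →
  -- q is an odd prime power
  Σ ℕ (λ p → Σ ℕ (λ m → Prime p × ¬ (2 ∣ p) × 1 ≤ m × q ≡ p ^ m)) →
  1 ≤ n → 2 ≤ k → k ≤ q →
  (F : FiniteField q) →
  (A : Fin n → Fin n → FiniteField.Carrier F) →
  FieldOps.Symmetric F n A → FieldOps.NonDegenerate F n A →
  (S : List (Vec (FiniteField.Carrier F) n)) → Unique S →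
  All (λ x → x ≢ replicate n (FiniteField.0# F)) S →
  FieldOps.Orthogonal-k2 F n k A S →
  -- |S| ≤ (k-1 + (k-1)^2/(q-k+1)) (q^(n/2) + 1), i.e. (since k-1+(k-1)^2/(q-k+1) = (k-1)q/(q-k+1))
  -- |S|(q-k+1) - (k-1)q ≤ (k-1) q √(q^n), squared (with truncated subtraction):
  ((length S * (q ∸ k + 1)) ∸ ((k ∸ 1) * q)) ^ 2 ≤ ((k ∸ 1) * q) ^ 2 * q ^ n
theorem2p3 q n zero    _ _ ()
theorem2p3 q n (suc r) _ _ _ k≤q F A A-symmetric A-nondegenerate S S-unique S-nonzero orthogonal =
  truncated-bound-from-moments r q (length S) N (q ^ n) k≤q (s*s≤r*[s+N] r orthogonal) second-moment-bound
  where
  open OrthogonalSets F A A-symmetric A-nondegenerate S S-unique S-nonzero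
  open SecondMoment
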